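{- (a) For each $i\ge 1$ there exists a linear function $\max_i:\mathrm{QSym}\to\mathbb{C}$ such that for every finite naturally labeled poset $P$, $\max_i(K_P(\mathbf{x}))=1$ if $P$ has exactly $i$ maximal elements and $\max_i(K_P(\mathbf{x}))=0$ otherwise. (b) For each $i\ge1$ there exists a linear function $\min_i:\mathrm{QSym}\to\mathbb{C}$ such that for every finite naturally labeled poset $P$, $\min_i(K_P(\mathbf{x}))=1$ if $P$ has exactly $i$ minimal elements and $\min_i(K_P(\mathbf{x}))=0$ otherwise.
   Context: $\mathrm{QSym}$ denotes the algebra of quasisymmetric functions over $\mathbb{C}$ in variables $x_1,x_2,\dots$. A poset $(P,\preceq)$ on ground set $[n]$ is naturally labeled if $x\preceq y$ implies $x\le y$ as integers. For such $P$, $K_P(\mathbf{x})=\sum_{\sigma}\prod_{p\in P}x_{\sigma(p)}\in\mathrm{QSym}$, the sum over all maps $\sigma:P\to\mathbb{Z}^+$ with $\sigma(x)\le\sigma(y)$ whenever $x\preceq y$. -}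

module Defs where

open import Data.Nat using (ℕ; zero; suc; _≤ᵇ_; _≡ᵇ_; _≤_)
open import Data.Bool using (Bool; true; false; not; _∧_; _∨_; if_then_else_)
open import Data.Fin using (Fin; toℕ; _≟_)
open import Data.List using (List; []; _∷_; [_]; map; concatMap; allFin; filterᵇ; upTo; foldr)
open import Data.Bool.ListAction using (all; any)
open import Data.Vec using (Vec; lookup) renaming ([] to []ᵥ; _∷_ to _∷ᵥ_)
open import Data.Product using (_×_; _,_)
open import Data.Rational using (ℚ; 0ℚ; 1ℚ; _+_; _*_)
open import Relation.Binary.PropositionalEquality using (_≡_)
open import Relation.Nullary.Decidable using (⌊_⌋)

countᵇ : {A : Set} → (A → Bool) → List A → ℕ
countᵇ p [] = zero
countᵇ p (x ∷ xs) = if p x then suc (countᵇ p xs) else countᵇ p xs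

_==F_ : {n : ℕ} → Fin n → Fin n → Bool
x ==F y = ⌊ x ≟ y ⌋

-- Finite posets on the ground set [n] = Fin n (relation given as a
-- Boolean matrix, so everything is decidable).

record Poset (n : ℕ) : Set where
  field
    rel     : Fin n → Fin n → Bool        -- rel x y ≡ true  means  x ⪯ y
    reflex  : ∀ x → rel x x ≡ true
    antisym : ∀ x y → rel x y ≡ true → rel y x ≡ true → x ≡ y
    transit : ∀ x y z → rel x y ≡ true → rel y z ≡ true → rel x z ≡ true
open Poset public

NaturallyLabeled : {n : ℕ} → Poset n → Set
NaturallyLabeled {n} P = ∀ x y → rel P x y ≡ true → toℕ x ≤ toℕ y

isMaximal : {n : ℕ} → Poset n → Fin n → Bool
isMaximal {n} P x = all (λ y → not (rel P x y) ∨ (y ==F x)) (allFin n)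

isMinimal : {n : ℕ} → Poset n → Fin n → Bool
isMinimal {n} P x = all (λ y → not (rel P y x) ∨ (y ==F x)) (allFin n)

numMaximal : {n : ℕ} → Poset n → ℕ
numMaximal {n} P = countᵇ (isMaximal P) (allFin n)

numMinimal : {n : ℕ} → Poset n → ℕ
numMinimal {n} P = countᵇ (isMinimal P) (allFin n)

-- QSym over ℚ, via its monomial basis M_α (α a composition).
-- An element of QSym is a formal finite ℚ-linear combination of M_α's.

Composition : Set
Composition = List ℕ   -- (only lists of positive parts ever occur below)

QSym : Set
QSym = List (ℚ × Composition)

-- A linear function QSym → ℚ is determined by (and freely determined by)
-- its values on the basis {M_α}; ⟦ f ⟧ is the linear extension.
LinFun : Set
LinFun = Composition → ℚ

⟦_⟧ : LinFun → QSym → ℚ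
⟦ f ⟧ v = foldr (λ { (c , α) acc → c * f α + acc }) 0ℚ v

-- A map σ : P → ℤ⁺ with values i₁ < … < i_k and
-- fibre sizes α₁,…,α_k corresponds to a surjective order-preserving
-- map P → [k] followed by the increasing map j ↦ i_j; hence
--   K_P = Σ_k Σ_{σ : P → [k] surjective, order-preserving} M_{type σ}.

allVecs : (k n : ℕ) → List (Vec (Fin k) n)
allVecs k zero = [ []ᵥ ]
allVecs k (suc n) = concatMap (λ v → map (λ j → j ∷ᵥ v) (allFin k)) (allVecs k n)

orderPreserving : {n k : ℕ} → Poset n → Vec (Fin k) n → Bool
orderPreserving {n} P σ =
  all (λ x → all (λ y → not (rel P x y) ∨ (toℕ (lookup σ x) ≤ᵇ toℕ (lookup σ y)))
                 (allFin n))
      (allFin n)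

surjective : {n k : ℕ} → Vec (Fin k) n → Bool
surjective {n} {k} σ = all (λ j → any (λ x → lookup σ x ==F j) (allFin n)) (allFin k)

fibreType : {n k : ℕ} → Vec (Fin k) n → Composition
fibreType {n} {k} σ = map (λ j → countᵇ (λ x → lookup σ x ==F j) (allFin n)) (allFin k)

K : {n : ℕ} → Poset n → QSym
K {n} P =
  concatMap (λ k → map (λ σ → (1ℚ , fibreType σ))
                       (filterᵇ (λ σ → orderPreserving P σ ∧ surjective σ) (allVecs k n)))
            (upTo (suc n))

indicator : ℕ → ℕ → ℚ
indicator a b = if a ≡ᵇ b then 1ℚ else 0ℚ

module Submission where

-- Expand K_P = Σ M_type(σ) over the order-preserving surjections σ : P → [k]. For
-- h : ℕ → ℚ let φ_h(M_α) = (-1)^ℓ (h N - h (N - α₁)) when α has length ℓ ≥ 1 and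
-- size N, and φ_h(M_∅) = h 0. Since 0 is minimal in a naturally labeled P, each σ
-- restricts on P ∖ 0 to a surjection u, after deleting the value σ(0) when only 0
-- takes it. Summing over the admissible values of σ(0) telescopes, so that
-- Ψ_d(P), the sum over σ of φ_h(M_type(σ)) computed with N := d + |P|, satisfies
--   Ψ_d(P) = Ψ_d(P ∖ 0) - [0 is maximal] Ψ_(d+1)(P ∖ 0).
-- As the maximal elements of P are those of P ∖ 0 plus possibly 0, induction gives
-- Ψ_d(P) = (δ^m h)(d) with m the number of maximal elements and δh(d) = h d - h (d+1).
-- For h(d) = (-1)^i C(d, i) we get (δ^m h)(0) = [m = i], so max_i = φ_h. Minimal
-- elements of P are maximal elements of its dual relabeled by x ↦ n - 1 - x, whose
-- K is obtained by reversing every composition, so min_i = max_i ∘ reverse.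

open import Defs
open import Data.Nat as ℕ using (ℕ; zero; suc; _≤_; _∸_; _≤ᵇ_; z≤n; s≤s)
import Data.Nat.Properties as ℕₚ
open import Data.Bool using (Bool; true; false; not; _∧_; _∨_; if_then_else_; T)
open import Data.Bool.Properties using (∨-zeroʳ; ∨-identityʳ; ∧-zeroʳ; T-≡)
open import Data.Bool.ListAction using (all; any; and; or)
open import Data.Fin as Fin using (Fin; zero; suc; toℕ; punchIn; punchOut; opposite; fromℕ; inject₁)
import Data.Fin.Properties as Finₚ
open import Data.List using (List; []; _∷_; _++_; _∷ʳ_; map; concatMap; allFin; filterᵇ; upTo; tabulate; length; reverse)
import Data.List.Properties as Listₚ
import Data.List.Relation.Unary.All.Properties as All
import Data.List.Relation.Unary.Any.Properties as Any
open import Data.Vec as Vec using (Vec; lookup)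
import Data.Vec.Properties as Vecₚ
open import Data.Product using (_×_; _,_; ∃-syntax; proj₁; proj₂)
open import Data.Rational using (ℚ; 0ℚ; 1ℚ; _+_; _*_; -_; _-_)
import Data.Rational.Properties as ℚₚ
open import Data.Rational.Solver using (module +-*-Solver)
open import Data.Nat.ListAction using (sum)
open import Algebra.Bundles using (CommutativeMonoid)
import Algebra.Properties.CommutativeSemigroup ℕₚ.+-commutativeSemigroup as ℕ+
import Algebra.Properties.CommutativeSemigroup (CommutativeMonoid.commutativeSemigroup ℚₚ.+-0-commutativeMonoid) as ℚ+
open import Function using (_∘_; id)
open import Function.Bundles using (module Equivalence)
open Equivalence using (to; from)
open import Relation.Binary.PropositionalEquality using (_≡_; refl; sym; trans; cong; cong₂; subst; subst₂; module ≡-Reasoning)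
open import Relation.Nullary using (Dec; yes; no; contradiction)
open import Relation.Nullary.Decidable using (toWitness; fromWitness)

open +-*-Solver using (solve; con; _:+_; _:-_; :-_; _:*_; _:=_)

private
  variable
    A B : Set

infixr 7 [_]·_

[_]·_ : Bool → ℚ → ℚ
[ b ]· x = if b then x else 0ℚ

[]·-+ : (b : Bool) (x y : ℚ) → [ b ]· (x + y) ≡ [ b ]· x + [ b ]· y
[]·-+ true x y = refl
[]·-+ false x y = sym (ℚₚ.+-identityˡ 0ℚ)

[]·-neg : (b : Bool) (x : ℚ) → [ b ]· (- x) ≡ - ([ b ]· x)
[]·-neg true x = refl
[]·-neg false x = refl

[]·-comm : (a b : Bool) (x : ℚ) → [ a ]· [ b ]· x ≡ [ b ]· [ a ]· x
[]·-comm true b x = refl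
[]·-comm false true x = refl
[]·-comm false false x = refl

[]·-∧-∧ : (a b c : Bool) (x : ℚ) → [ (a ∧ b) ∧ c ]· x ≡ [ b ∧ c ]· [ a ]· x
[]·-∧-∧ true b c x = refl
[]·-∧-∧ false b c x = sym ([]·-comm (b ∧ c) false x)

[]·-nor : (a b : Bool) (x : ℚ) → [ not (a ∨ b) ]· x ≡ [ not b ]· [ not a ]· x
[]·-nor true b x = sym ([]·-comm (not b) false x)
[]·-nor false b x = refl

∑ : List A → (A → ℚ) → ℚ
∑ [] F = 0ℚ
∑ (x ∷ xs) F = F x + ∑ xs F

infix 7 ∑
syntax ∑ xs (λ x → e) = ∑[ x ← xs ] e

∑-cong : (xs : List A) {F G : A → ℚ} → (∀ x → F x ≡ G x) → ∑ xs F ≡ ∑ xs G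
∑-cong [] F≗G = refl
∑-cong (x ∷ xs) F≗G = cong₂ _+_ (F≗G x) (∑-cong xs F≗G)

∑-++ : (xs ys : List A) (F : A → ℚ) → ∑ (xs ++ ys) F ≡ ∑ xs F + ∑ ys F
∑-++ [] ys F = sym (ℚₚ.+-identityˡ _)
∑-++ (x ∷ xs) ys F = trans (cong (F x +_) (∑-++ xs ys F)) (sym (ℚₚ.+-assoc (F x) _ _))

∑-∷ʳ : (xs : List A) (x : A) (F : A → ℚ) → ∑ (xs ∷ʳ x) F ≡ ∑ xs F + F x
∑-∷ʳ xs x F = trans (∑-++ xs (x ∷ []) F) (cong (∑ xs F +_) (ℚₚ.+-identityʳ (F x)))

∑-map : (g : B → A) (xs : List B) (F : A → ℚ) → ∑ (map g xs) F ≡ ∑ xs (F ∘ g)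
∑-map g [] F = refl
∑-map g (x ∷ xs) F = cong (F (g x) +_) (∑-map g xs F)

∑-concatMap : (g : B → List A) (xs : List B) (F : A → ℚ) →
              ∑ (concatMap g xs) F ≡ ∑[ x ← xs ] ∑ (g x) F
∑-concatMap g [] F = refl
∑-concatMap g (x ∷ xs) F = trans (∑-++ (g x) (concatMap g xs) F) (cong (∑ (g x) F +_) (∑-concatMap g xs F))

∑-zero : (xs : List A) → ∑[ x ← xs ] 0ℚ ≡ 0ℚ
∑-zero [] = refl
∑-zero (x ∷ xs) = trans (ℚₚ.+-identityˡ _) (∑-zero xs)

∑-+ : (xs : List A) (F G : A → ℚ) → ∑[ x ← xs ] (F x + G x) ≡ ∑ xs F + ∑ xs G
∑-+ [] F G = refl
∑-+ (x ∷ xs) F G = trans (cong (F x + G x +_) (∑-+ xs F G)) (ℚ+.interchange (F x) (G x) _ _)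

∑-neg : (xs : List A) (F : A → ℚ) → ∑[ x ← xs ] (- F x) ≡ - ∑ xs F
∑-neg [] F = refl
∑-neg (x ∷ xs) F = trans (cong (- F x +_) (∑-neg xs F)) (sym (ℚₚ.neg-distrib-+ (F x) _))

∑-[]· : (xs : List A) (b : Bool) (F : A → ℚ) → ∑[ x ← xs ] [ b ]· F x ≡ [ b ]· ∑ xs F
∑-[]· xs true F = refl
∑-[]· xs false F = ∑-zero xs

∑-comm : (xs : List A) (ys : List B) (F : A → B → ℚ) →
         ∑[ x ← xs ] ∑[ y ← ys ] F x y ≡ ∑[ y ← ys ] ∑[ x ← xs ] F x y
∑-comm [] ys F = sym (∑-zero ys)
∑-comm (x ∷ xs) ys F = trans (cong (∑ ys (F x) +_) (∑-comm xs ys F)) (sym (∑-+ ys (F x) _))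

∑-filterᵇ : (p : A → Bool) (xs : List A) (F : A → ℚ) → ∑ (filterᵇ p xs) F ≡ ∑[ x ← xs ] [ p x ]· F x
∑-filterᵇ p [] F = refl
∑-filterᵇ p (x ∷ xs) F with p x
... | true = cong (F x +_) (∑-filterᵇ p xs F)
... | false = trans (∑-filterᵇ p xs F) (sym (ℚₚ.+-identityˡ _))

∑-tabulate : {n : ℕ} (f : Fin n → A) (F : A → ℚ) → ∑ (tabulate f) F ≡ ∑ (allFin n) (F ∘ f)
∑-tabulate f F = trans (cong (λ xs → ∑ xs F) (sym (Listₚ.map-tabulate id f))) (∑-map f (allFin _) F)

∑-upTo-suc : (m : ℕ) (F : ℕ → ℚ) → ∑ (upTo (suc m)) F ≡ F 0 + ∑ (upTo m) (F ∘ suc)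
∑-upTo-suc m F = cong (F 0 +_) (trans (cong (λ xs → ∑ xs F) (sym (Listₚ.map-applyUpTo id suc m))) (∑-map suc (upTo m) F))

∑-upTo-∷ʳ : (m : ℕ) (F : ℕ → ℚ) → ∑ (upTo (suc m)) F ≡ ∑ (upTo m) F + F m
∑-upTo-∷ʳ m F = trans (cong (λ xs → ∑ xs F) (sym (Listₚ.upTo-∷ʳ m))) (∑-∷ʳ (upTo m) m F)

∑-sub-[]· : (xs : List A) (b : Bool) (F G : A → ℚ) → ∑[ x ← xs ] (F x - [ b ]· G x) ≡ ∑ xs F - [ b ]· ∑ xs G
∑-sub-[]· xs b F G = trans (∑-+ xs F (λ x → - ([ b ]· G x)))
  (cong (∑ xs F +_) (trans (∑-neg xs (λ x → [ b ]· G x)) (cong -_ (∑-[]· xs b G))))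

∑-reverse : (xs : List A) (F : A → ℚ) → ∑ (reverse xs) F ≡ ∑ xs F
∑-reverse [] F = refl
∑-reverse (x ∷ xs) F = begin
  ∑ (reverse (x ∷ xs)) F  ≡⟨ cong (λ ys → ∑ ys F) (Listₚ.unfold-reverse x xs) ⟩
  ∑ (reverse xs ∷ʳ x) F   ≡⟨ ∑-∷ʳ (reverse xs) x F ⟩
  ∑ (reverse xs) F + F x  ≡⟨ cong (_+ F x) (∑-reverse xs F) ⟩
  ∑ xs F + F x            ≡⟨ ℚₚ.+-comm (∑ xs F) (F x) ⟩
  F x + ∑ xs F            ∎
  where open ≡-Reasoning

Bool-ext : {a b : Bool} → (a ≡ true → b ≡ true) → (b ≡ true → a ≡ true) → a ≡ b
Bool-ext {true} a⇒b b⇒a = sym (a⇒b refl)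
Bool-ext {false} {true} a⇒b b⇒a = b⇒a refl
Bool-ext {false} {false} a⇒b b⇒a = refl

module _ {n : ℕ} where

  ==F-refl : (x : Fin n) → (x ==F x) ≡ true
  ==F-refl x = to T-≡ (fromWitness refl)

  ≡⇒==F : {x y : Fin n} → x ≡ y → (x ==F y) ≡ true
  ≡⇒==F {x} refl = ==F-refl x

  ==F⇒≡ : {x y : Fin n} → (x ==F y) ≡ true → x ≡ y
  ==F⇒≡ x==y = toWitness (subst T (sym x==y) _)

  ==F-suc : (x y : Fin n) → (suc x ==F suc y) ≡ (x ==F y)
  ==F-suc x y with x Fin.≟ y
  ... | yes _ = refl
  ... | no _ = refl

  all-tabulate : (p : A → Bool) (f : Fin n → A) → all p (tabulate f) ≡ all (p ∘ f) (allFin n)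
  all-tabulate p f = cong and (trans (Listₚ.map-tabulate f p) (sym (Listₚ.map-tabulate id (p ∘ f))))

  any-tabulate : (p : A → Bool) (f : Fin n → A) → any p (tabulate f) ≡ any (p ∘ f) (allFin n)
  any-tabulate p f = cong or (trans (Listₚ.map-tabulate f p) (sym (Listₚ.map-tabulate id (p ∘ f))))

  all-allFin⁻ : {p : Fin n → Bool} → all p (allFin n) ≡ true → ∀ x → p x ≡ true
  all-allFin⁻ {p} ∀p x = to T-≡ (All.tabulate⁻ (All.all⁺ p (allFin n) (from T-≡ ∀p)) x)

  all-allFin⁺ : {p : Fin n → Bool} → (∀ x → p x ≡ true) → all p (allFin n) ≡ true
  all-allFin⁺ {p} ∀p = to T-≡ (All.all⁻ p (All.tabulate⁺ (from T-≡ ∘ ∀p)))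

  any-allFin⁻ : {p : Fin n → Bool} → any p (allFin n) ≡ true → ∃[ x ] p x ≡ true
  any-allFin⁻ {p} ∃p = let x , px = Any.tabulate⁻ (Any.any⁻ p (allFin n) (from T-≡ ∃p)) in x , to T-≡ px

  any-allFin⁺ : {p : Fin n → Bool} (x : Fin n) → p x ≡ true → any p (allFin n) ≡ true
  any-allFin⁺ {p} x px = to T-≡ (Any.any⁺ p (Any.tabulate⁺ x (from T-≡ px)))

all-cong : (xs : List A) {p q : A → Bool} → (∀ x → p x ≡ q x) → all p xs ≡ all q xs
all-cong xs p≗q = cong and (Listₚ.map-cong p≗q xs)

any-cong : (xs : List A) {p q : A → Bool} → (∀ x → p x ≡ q x) → any p xs ≡ any q xs
any-cong xs p≗q = cong or (Listₚ.map-cong p≗q xs)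

countᵇ-map : (p : A → Bool) (f : B → A) (xs : List B) → countᵇ p (map f xs) ≡ countᵇ (p ∘ f) xs
countᵇ-map p f [] = refl
countᵇ-map p f (x ∷ xs) with p (f x)
... | true = cong suc (countᵇ-map p f xs)
... | false = countᵇ-map p f xs

countᵇ-cong : (xs : List A) {p q : A → Bool} → (∀ x → p x ≡ q x) → countᵇ p xs ≡ countᵇ q xs
countᵇ-cong [] p≗q = refl
countᵇ-cong (x ∷ xs) {p} {q} p≗q rewrite p≗q x with q x
... | true = cong suc (countᵇ-cong xs p≗q)
... | false = countᵇ-cong xs p≗q

countᵇ-++ : (p : A → Bool) (xs ys : List A) → countᵇ p (xs ++ ys) ≡ countᵇ p xs ℕ.+ countᵇ p ys
countᵇ-++ p [] ys = refl
countᵇ-++ p (x ∷ xs) ys with p x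
... | true = cong suc (countᵇ-++ p xs ys)
... | false = countᵇ-++ p xs ys

module _ {n : ℕ} where

  all-allFin-suc : (p : Fin (suc n) → Bool) → all p (allFin (suc n)) ≡ p zero ∧ all (p ∘ suc) (allFin n)
  all-allFin-suc p = cong (p zero ∧_) (all-tabulate p suc)

  any-allFin-suc : (p : Fin (suc n) → Bool) → any p (allFin (suc n)) ≡ p zero ∨ any (p ∘ suc) (allFin n)
  any-allFin-suc p = cong (p zero ∨_) (any-tabulate p suc)

  countᵇ-allFin-suc : (p : Fin (suc n) → Bool) →
    countᵇ p (allFin (suc n)) ≡ (if p zero then suc (countᵇ (p ∘ suc) (allFin n)) else countᵇ (p ∘ suc) (allFin n))
  countᵇ-allFin-suc p = cong (λ c → if p zero then suc c else c)
    (trans (cong (countᵇ p) (sym (Listₚ.map-tabulate id suc))) (countᵇ-map p suc (allFin n)))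

  ∑-allFin-suc : (F : Fin (suc n) → ℚ) → ∑ (allFin (suc n)) F ≡ F zero + ∑ (allFin n) (F ∘ suc)
  ∑-allFin-suc F = cong (F zero +_) (∑-tabulate suc F)

allFin-suc : (n : ℕ) → allFin (suc n) ≡ zero ∷ map suc (allFin n)
allFin-suc n = cong (zero ∷_) (sym (Listₚ.map-tabulate id suc))

allFin-∷ʳ : (n : ℕ) → allFin (suc n) ≡ map inject₁ (allFin n) ∷ʳ fromℕ n
allFin-∷ʳ zero = refl
allFin-∷ʳ (suc n) = begin
  allFin (suc (suc n))
    ≡⟨ allFin-suc (suc n) ⟩
  zero ∷ map suc (allFin (suc n))
    ≡⟨ cong (λ xs → zero ∷ map suc xs) (allFin-∷ʳ n) ⟩
  zero ∷ map suc (map inject₁ (allFin n) ∷ʳ fromℕ n)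
    ≡⟨ cong (zero ∷_) (Listₚ.map-++ suc (map inject₁ (allFin n)) (fromℕ n ∷ [])) ⟩
  zero ∷ (map suc (map inject₁ (allFin n)) ∷ʳ suc (fromℕ n))
    ≡⟨ cong (λ xs → zero ∷ (xs ∷ʳ suc (fromℕ n))) (trans (sym (Listₚ.map-∘ (allFin n))) (Listₚ.map-∘ (allFin n))) ⟩
  zero ∷ (map inject₁ (map suc (allFin n)) ∷ʳ suc (fromℕ n))
    ≡⟨ cong (λ xs → map inject₁ xs ∷ʳ suc (fromℕ n)) (allFin-suc n) ⟨
  map inject₁ (allFin (suc n)) ∷ʳ fromℕ (suc n) ∎
  where open ≡-Reasoning

∑-allFin-toℕ-∷ʳ : (m : ℕ) (F : ℕ → ℚ) → ∑ (allFin (suc m)) (F ∘ toℕ) ≡ ∑ (allFin m) (F ∘ toℕ) + F m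
∑-allFin-toℕ-∷ʳ m F = begin
  ∑ (allFin (suc m)) (F ∘ toℕ)
    ≡⟨ cong (λ xs → ∑ xs (F ∘ toℕ)) (allFin-∷ʳ m) ⟩
  ∑ (map inject₁ (allFin m) ∷ʳ fromℕ m) (F ∘ toℕ)
    ≡⟨ ∑-∷ʳ (map inject₁ (allFin m)) (fromℕ m) (F ∘ toℕ) ⟩
  ∑ (map inject₁ (allFin m)) (F ∘ toℕ) + F (toℕ (fromℕ m))
    ≡⟨ cong₂ _+_ (trans (∑-map inject₁ (allFin m) (F ∘ toℕ)) (∑-cong (allFin m) (cong F ∘ Finₚ.toℕ-inject₁)))
                 (cong F (Finₚ.toℕ-fromℕ m)) ⟩
  ∑ (allFin m) (F ∘ toℕ) + F m ∎
  where open ≡-Reasoning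

countᵇ-none : (xs : List A) {p : A → Bool} → (∀ x → p x ≡ false) → countᵇ p xs ≡ 0
countᵇ-none [] none = refl
countᵇ-none (x ∷ xs) {p} none rewrite none x = countᵇ-none xs none

countᵇ-reverse : (p : A → Bool) (xs : List A) → countᵇ p (reverse xs) ≡ countᵇ p xs
countᵇ-reverse p [] = refl
countᵇ-reverse p (x ∷ xs) = begin
  countᵇ p (reverse (x ∷ xs))                ≡⟨ cong (countᵇ p) (Listₚ.unfold-reverse x xs) ⟩
  countᵇ p (reverse xs ∷ʳ x)                 ≡⟨ countᵇ-++ p (reverse xs) (x ∷ []) ⟩
  countᵇ p (reverse xs) ℕ.+ countᵇ p (x ∷ []) ≡⟨ cong (ℕ._+ countᵇ p (x ∷ [])) (countᵇ-reverse p xs) ⟩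
  countᵇ p xs ℕ.+ countᵇ p (x ∷ [])           ≡⟨ ℕₚ.+-comm (countᵇ p xs) _ ⟩
  countᵇ p (x ∷ []) ℕ.+ countᵇ p xs           ≡⟨ countᵇ-++ p (x ∷ []) xs ⟨
  countᵇ p (x ∷ xs)                          ∎
  where open ≡-Reasoning

≤ᵇ-refl : (m : ℕ) → (m ≤ᵇ m) ≡ true
≤ᵇ-refl m = to T-≡ (ℕₚ.≤⇒≤ᵇ (ℕₚ.≤-refl {m}))

≤ᵇ-cong-⇔ : {a b c d : ℕ} → (a ≤ b → c ≤ d) → (c ≤ d → a ≤ b) → (a ≤ᵇ b) ≡ (c ≤ᵇ d)
≤ᵇ-cong-⇔ {a} {b} {c} {d} ⇒ ⇐ = Bool-ext
  (λ a≤b → to T-≡ (ℕₚ.≤⇒≤ᵇ (⇒ (ℕₚ.≤ᵇ⇒≤ a b (from T-≡ a≤b)))))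
  (λ c≤d → to T-≡ (ℕₚ.≤⇒≤ᵇ (⇐ (ℕₚ.≤ᵇ⇒≤ c d (from T-≡ c≤d)))))

map-opposite-allFin : (n : ℕ) → map opposite (allFin n) ≡ reverse (allFin n)
map-opposite-allFin zero = refl
map-opposite-allFin (suc n) = begin
  map opposite (allFin (suc n))
    ≡⟨ cong (map opposite) (allFin-suc n) ⟩
  fromℕ n ∷ map opposite (map suc (allFin n))
    ≡⟨ cong (fromℕ n ∷_) (trans (sym (Listₚ.map-∘ (allFin n))) (Listₚ.map-∘ (allFin n))) ⟩
  fromℕ n ∷ map inject₁ (map opposite (allFin n))
    ≡⟨ cong (λ xs → fromℕ n ∷ map inject₁ xs) (map-opposite-allFin n) ⟩
  fromℕ n ∷ map inject₁ (reverse (allFin n))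
    ≡⟨ cong (fromℕ n ∷_) (Listₚ.reverse-map inject₁ (allFin n)) ⟩
  fromℕ n ∷ reverse (map inject₁ (allFin n))
    ≡⟨ Listₚ.reverse-++ (map inject₁ (allFin n)) (fromℕ n ∷ []) ⟨
  reverse (map inject₁ (allFin n) ∷ʳ fromℕ n)
    ≡⟨ cong reverse (allFin-∷ʳ n) ⟨
  reverse (allFin (suc n)) ∎
  where open ≡-Reasoning

module _ {n : ℕ} where

  ∑-allFin-opposite : (F : Fin n → ℚ) → ∑ (allFin n) (F ∘ opposite) ≡ ∑ (allFin n) F
  ∑-allFin-opposite F = begin
    ∑ (allFin n) (F ∘ opposite)      ≡⟨ ∑-map opposite (allFin n) F ⟨
    ∑ (map opposite (allFin n)) F    ≡⟨ cong (λ xs → ∑ xs F) (map-opposite-allFin n) ⟩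
    ∑ (reverse (allFin n)) F         ≡⟨ ∑-reverse (allFin n) F ⟩
    ∑ (allFin n) F                   ∎
    where open ≡-Reasoning

  countᵇ-opposite : (p : Fin n → Bool) → countᵇ (p ∘ opposite) (allFin n) ≡ countᵇ p (allFin n)
  countᵇ-opposite p = begin
    countᵇ (p ∘ opposite) (allFin n)    ≡⟨ countᵇ-map p opposite (allFin n) ⟨
    countᵇ p (map opposite (allFin n))  ≡⟨ cong (countᵇ p) (map-opposite-allFin n) ⟩
    countᵇ p (reverse (allFin n))       ≡⟨ countᵇ-reverse p (allFin n) ⟩
    countᵇ p (allFin n)                 ∎
    where open ≡-Reasoning

  all-opposite : (p : Fin n → Bool) → all (p ∘ opposite) (allFin n) ≡ all p (allFin n)
  all-opposite p = Bool-ext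
    (λ ∀p∘opp → all-allFin⁺ {p = p} (λ x → subst (λ y → p y ≡ true) (Finₚ.opposite-involutive x)
      (all-allFin⁻ {p = p ∘ opposite} ∀p∘opp (opposite x))))
    (λ ∀p → all-allFin⁺ {p = p ∘ opposite} (λ x → all-allFin⁻ {p = p} ∀p (opposite x)))

  any-opposite : (p : Fin n → Bool) → any (p ∘ opposite) (allFin n) ≡ any p (allFin n)
  any-opposite p = Bool-ext
    (λ ∃p∘opp → let x , px = any-allFin⁻ {p = p ∘ opposite} ∃p∘opp in any-allFin⁺ {p = p} (opposite x) px)
    (λ ∃p → let x , px = any-allFin⁻ {p = p} ∃p in
      any-allFin⁺ {p = p ∘ opposite} (opposite x) (subst (λ y → p y ≡ true) (sym (Finₚ.opposite-involutive x)) px))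

  all-comm : (R : Fin n → Fin n → Bool) →
    all (λ x → all (λ y → R x y) (allFin n)) (allFin n) ≡ all (λ y → all (λ x → R x y) (allFin n)) (allFin n)
  all-comm R = Bool-ext
    (λ h → all-allFin⁺ {p = λ y → all (λ x → R x y) (allFin n)} (λ y → all-allFin⁺ {p = λ x → R x y} (λ x →
      all-allFin⁻ {p = R x} (all-allFin⁻ {p = λ x → all (R x) (allFin n)} h x) y)))
    (λ h → all-allFin⁺ {p = λ x → all (R x) (allFin n)} (λ x → all-allFin⁺ {p = R x} (λ y →
      all-allFin⁻ {p = λ x → R x y} (all-allFin⁻ {p = λ y → all (λ x → R x y) (allFin n)} h y) x)))

  opposite-==F : (a b : Fin n) → (opposite a ==F b) ≡ (a ==F opposite b)
  opposite-==F a b = Bool-ext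
    (λ e → ≡⇒==F (trans (sym (Finₚ.opposite-involutive a)) (cong opposite (==F⇒≡ e))))
    (λ e → ≡⇒==F (trans (cong opposite (==F⇒≡ e)) (Finₚ.opposite-involutive b)))

  opposite-≤ : (a b : Fin n) → toℕ a ≤ toℕ b → toℕ (opposite b) ≤ toℕ (opposite a)
  opposite-≤ a b a≤b rewrite Finₚ.opposite-prop a | Finₚ.opposite-prop b = ℕₚ.∸-monoʳ-≤ n (s≤s a≤b)

  opposite-≤⁻ : (a b : Fin n) → toℕ (opposite a) ≤ toℕ (opposite b) → toℕ b ≤ toℕ a
  opposite-≤⁻ a b a*≤b* = subst₂ (λ u v → toℕ u ≤ toℕ v) (Finₚ.opposite-involutive b) (Finₚ.opposite-involutive a)
    (opposite-≤ (opposite a) (opposite b) a*≤b*)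

  opposite-≤ᵇ : (a b : Fin n) → (toℕ (opposite a) ≤ᵇ toℕ (opposite b)) ≡ (toℕ b ≤ᵇ toℕ a)
  opposite-≤ᵇ a b = ≤ᵇ-cong-⇔ (opposite-≤⁻ a b) (opposite-≤ b a)

sum-map-+ : (f g : A → ℕ) (xs : List A) → sum (map (λ x → f x ℕ.+ g x) xs) ≡ sum (map f xs) ℕ.+ sum (map g xs)
sum-map-+ f g [] = refl
sum-map-+ f g (x ∷ xs) = trans (cong (f x ℕ.+ g x ℕ.+_) (sum-map-+ f g xs)) (ℕ+.interchange (f x) (g x) _ _)

sum-zeros : (xs : List A) {f : A → ℕ} → (∀ x → f x ≡ 0) → sum (map f xs) ≡ 0
sum-zeros [] f≗0 = refl
sum-zeros (x ∷ xs) f≗0 = cong₂ ℕ._+_ (f≗0 x) (sum-zeros xs f≗0)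

sum-allFin-suc : {k : ℕ} (f : Fin (suc k) → ℕ) → sum (map f (allFin (suc k))) ≡ f zero ℕ.+ sum (map (f ∘ suc) (allFin k))
sum-allFin-suc {k} f = cong (λ xs → f zero ℕ.+ sum xs) (trans (Listₚ.map-tabulate suc f) (sym (Listₚ.map-tabulate id (f ∘ suc))))

fromBool : Bool → ℕ
fromBool b = if b then 1 else 0

sum-indicators : {k : ℕ} (j : Fin k) → sum (map (λ i → fromBool (j ==F i)) (allFin k)) ≡ 1
sum-indicators {suc k} zero = trans (sum-allFin-suc {k} (λ i → fromBool (zero ==F i)))
  (cong suc (sum-zeros (allFin k) {λ i → fromBool (zero ==F suc i)} (λ _ → refl)))
sum-indicators {suc k} (suc j) = trans (sum-allFin-suc {k} (λ i → fromBool (suc j ==F i)))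
  (trans (cong sum (Listₚ.map-cong (λ i → cong fromBool (==F-suc j i)) (allFin k))) (sum-indicators j))

-- Deleting the least element of a naturally labeled poset

deleteZero : {n : ℕ} → Poset (suc n) → Poset n
deleteZero P = record
  { rel = λ x y → rel P (suc x) (suc y)
  ; reflex = λ x → reflex P (suc x)
  ; antisym = λ x y x⪯y y⪯x → Finₚ.suc-injective (antisym P (suc x) (suc y) x⪯y y⪯x)
  ; transit = λ x y z → transit P (suc x) (suc y) (suc z)
  }

extendableAt : {n k : ℕ} → Poset (suc n) → ℕ → Vec (Fin k) n → Bool
extendableAt {n} P t τ = all (λ y → not (rel P zero (suc y)) ∨ (t ≤ᵇ toℕ (lookup τ y))) (allFin n)

module _ {n : ℕ} (P : Poset (suc n)) (nl : NaturallyLabeled P) where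

  NaturallyLabeled-deleteZero : NaturallyLabeled (deleteZero P)
  NaturallyLabeled-deleteZero x y x⪯y = ℕ.s≤s⁻¹ (nl (suc x) (suc y) x⪯y)

  rel-suc-zero : (x : Fin n) → rel P (suc x) zero ≡ false
  rel-suc-zero x with rel P (suc x) zero in x⪯0
  ... | false = refl
  ... | true with nl (suc x) zero x⪯0
  ...   | ()

  isMaximal-suc : (y : Fin n) → isMaximal P (suc y) ≡ isMaximal (deleteZero P) y
  isMaximal-suc y = trans (all-allFin-suc (λ z → not (rel P (suc y) z) ∨ (z ==F suc y)))
    (cong₂ (λ b c → (not b ∨ false) ∧ c) (rel-suc-zero y)
           (all-cong (allFin n) (λ z → cong (not (rel P (suc y) (suc z)) ∨_) (==F-suc z y))))

  numMaximal-deleteZero : numMaximal P ≡ (if isMaximal P zero then suc (numMaximal (deleteZero P)) else numMaximal (deleteZero P))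
  numMaximal-deleteZero = trans (countᵇ-allFin-suc (isMaximal P))
    (cong (λ m → if isMaximal P zero then suc m else m) (countᵇ-cong (allFin n) isMaximal-suc))

  orderPreserving-∷ : {k : ℕ} (j : Fin k) (τ : Vec (Fin k) n) →
    orderPreserving P (j Vec.∷ τ) ≡ extendableAt P (toℕ j) τ ∧ orderPreserving (deleteZero P) τ
  orderPreserving-∷ j τ = trans (all-allFin-suc row) (cong₂ _∧_ row-zero (all-cong (allFin n) row-suc))
    where
    entry : Fin (suc n) → Fin (suc n) → Bool
    entry x y = not (rel P x y) ∨ (toℕ (lookup (j Vec.∷ τ) x) ≤ᵇ toℕ (lookup (j Vec.∷ τ) y))
    row : Fin (suc n) → Bool
    row x = all (entry x) (allFin (suc n))
    row-zero : row zero ≡ extendableAt P (toℕ j) τ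
    row-zero = trans (all-allFin-suc (entry zero))
      (cong (_∧ extendableAt P (toℕ j) τ) (trans (cong (not (rel P zero zero) ∨_) (≤ᵇ-refl (toℕ j))) (∨-zeroʳ _)))
    row-suc : ∀ x → row (suc x) ≡ all (λ y → not (rel P (suc x) (suc y)) ∨ (toℕ (lookup τ x) ≤ᵇ toℕ (lookup τ y))) (allFin n)
    row-suc x = trans (all-allFin-suc (entry (suc x)))
      (cong (λ b → (not b ∨ (toℕ (lookup τ x) ≤ᵇ toℕ j)) ∧ all (entry (suc x) ∘ suc) (allFin n)) (rel-suc-zero x))

module _ {n k : ℕ} (P : Poset (suc n)) (τ : Vec (Fin k) n) where

  extendableAt-zero : extendableAt P 0 τ ≡ true
  extendableAt-zero = all-allFin⁺ (λ y → ∨-zeroʳ (not (rel P zero (suc y))))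

  extendableAt-top : extendableAt P k τ ≡ isMaximal P zero
  extendableAt-top = Bool-ext (all-allFin⁺ ∘ ⇒) ⇐
    where
    k≰ : (w : Fin k) → (k ≤ᵇ toℕ w) ≡ false
    k≰ w with k ≤ᵇ toℕ w in k≤w
    ... | false = refl
    ... | true = contradiction (ℕₚ.≤ᵇ⇒≤ k (toℕ w) (from T-≡ k≤w)) (ℕₚ.<⇒≱ (Finₚ.toℕ<n w))
    ⇒ : extendableAt P k τ ≡ true → ∀ y → (not (rel P zero y) ∨ (y ==F zero)) ≡ true
    ⇒ ext zero = ∨-zeroʳ _
    ⇒ ext (suc y) = trans (cong (not (rel P zero (suc y)) ∨_) (sym (k≰ (lookup τ y)))) (all-allFin⁻ ext y)
    ⇐ : isMaximal P zero ≡ true → extendableAt P k τ ≡ true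
    ⇐ max = all-allFin⁺ (λ y → cong (_∨ (k ≤ᵇ toℕ (lookup τ y))) (trans (sym (∨-identityʳ _)) (all-allFin⁻ max (suc y))))

module _ {k : ℕ} (j : Fin (suc k)) where

  ≤ᵇ-punchIn : (a b : Fin k) → (toℕ (punchIn j a) ≤ᵇ toℕ (punchIn j b)) ≡ (toℕ a ≤ᵇ toℕ b)
  ≤ᵇ-punchIn a b = ≤ᵇ-cong-⇔ (Finₚ.punchIn-cancel-≤ j a b) (Finₚ.punchIn-mono-≤ j a b)

  ≤ᵇ-punchInʳ : (a : Fin k) → (toℕ j ≤ᵇ toℕ (punchIn j a)) ≡ (toℕ j ≤ᵇ toℕ a)
  ≤ᵇ-punchInʳ a = ≤ᵇ-cong-⇔ (cancel j a) (λ j≤a → ℕₚ.≤-trans j≤a (inflationary j a))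
    where
    inflationary : {k : ℕ} (j : Fin (suc k)) (a : Fin k) → toℕ a ≤ toℕ (punchIn j a)
    inflationary zero a = ℕₚ.n≤1+n (toℕ a)
    inflationary (suc j) zero = z≤n
    inflationary (suc j) (suc a) = s≤s (inflationary j a)
    cancel : {k : ℕ} (j : Fin (suc k)) (a : Fin k) → toℕ j ≤ toℕ (punchIn j a) → toℕ j ≤ toℕ a
    cancel zero a _ = z≤n
    cancel (suc j) (suc a) (s≤s j≤a) = s≤s (cancel j a j≤a)

  orderPreserving-punchIn : {n : ℕ} (Q : Poset n) (u : Vec (Fin k) n) →
    orderPreserving Q (Vec.map (punchIn j) u) ≡ orderPreserving Q u
  orderPreserving-punchIn {n} Q u = all-cong (allFin n) (λ x → all-cong (allFin n) (λ y →
    cong (not (rel Q x y) ∨_) (trans (cong₂ (λ a b → toℕ a ≤ᵇ toℕ b) (Vecₚ.lookup-map x (punchIn j) u) (Vecₚ.lookup-map y (punchIn j) u))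
                                     (≤ᵇ-punchIn (lookup u x) (lookup u y)))))

  extendableAt-punchIn : {n : ℕ} (P : Poset (suc n)) (u : Vec (Fin k) n) →
    extendableAt P (toℕ j) (Vec.map (punchIn j) u) ≡ extendableAt P (toℕ j) u
  extendableAt-punchIn {n} P u = all-cong (allFin n) (λ y → cong (not (rel P zero (suc y)) ∨_)
    (trans (cong (λ a → toℕ j ≤ᵇ toℕ a) (Vecₚ.lookup-map y (punchIn j) u)) (≤ᵇ-punchInʳ (lookup u y))))

hits : {n k : ℕ} → Vec (Fin k) n → Fin k → Bool
hits {n} τ j = any (λ x → lookup τ x ==F j) (allFin n)

module _ {n k : ℕ} (τ : Vec (Fin k) n) where

  surjective⁻ : surjective τ ≡ true → ∀ j → hits τ j ≡ true
  surjective⁻ = all-allFin⁻ {p = hits τ}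

  surjective⁺ : (∀ j → hits τ j ≡ true) → surjective τ ≡ true
  surjective⁺ = all-allFin⁺ {p = hits τ}

  hits⁻ : {j : Fin k} → hits τ j ≡ true → ∃[ x ] lookup τ x ≡ j
  hits⁻ {j} h = let x , τx≡j = any-allFin⁻ {p = λ x → lookup τ x ==F j} h in x , ==F⇒≡ τx≡j

  hits⁺ : {j : Fin k} (x : Fin n) → lookup τ x ≡ j → hits τ j ≡ true
  hits⁺ {j} x τx≡j = any-allFin⁺ {p = λ x → lookup τ x ==F j} x (≡⇒==F τx≡j)

module _ {n k : ℕ} (j : Fin k) (τ : Vec (Fin k) n) where

  hits-∷ : (i : Fin k) → hits (j Vec.∷ τ) i ≡ (j ==F i) ∨ hits τ i
  hits-∷ i = any-allFin-suc (λ x → lookup (j Vec.∷ τ) x ==F i)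

  surjective-∷ : surjective τ ≡ true → surjective (j Vec.∷ τ) ≡ true
  surjective-∷ s = surjective⁺ (j Vec.∷ τ) (λ i → trans (hits-∷ i) (trans (cong ((j ==F i) ∨_) (surjective⁻ τ s i)) (∨-zeroʳ _)))

  hits⇒surjective-∷ : hits τ j ≡ true → surjective (j Vec.∷ τ) ≡ surjective τ
  hits⇒surjective-∷ h = all-cong (allFin k) (λ i → trans (hits-∷ i) (redundant i))
    where
    redundant : ∀ i → (j ==F i) ∨ hits τ i ≡ hits τ i
    redundant i with j Fin.≟ i
    ... | yes refl = sym h
    ... | no _ = refl

  []·-surjective-∷ : (c : Bool) (x : ℚ) →
    [ c ∧ surjective (j Vec.∷ τ) ]· x ≡ [ c ∧ surjective τ ]· x + [ not (hits τ j) ]· [ c ∧ surjective (j Vec.∷ τ) ]· x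
  []·-surjective-∷ c x with surjective τ in s | hits τ j in h
  ... | true | true rewrite surjective-∷ s = sym (ℚₚ.+-identityʳ _)
  ... | true | false = contradiction (trans (sym h) (surjective⁻ τ s j)) λ ()
  ... | false | true rewrite hits⇒surjective-∷ h | s | ∧-zeroʳ c = refl
  ... | false | false rewrite ∧-zeroʳ c = sym (ℚₚ.+-identityˡ _)

module _ {n k : ℕ} (j : Fin (suc k)) (u : Vec (Fin k) n) where

  surjective-∷-punchIn : surjective (j Vec.∷ Vec.map (punchIn j) u) ≡ surjective u
  surjective-∷-punchIn = Bool-ext (surjective⁺ u ∘ ⇒) (surjective⁺ (j Vec.∷ Vec.map (punchIn j) u) ∘ ⇐)
    where
    ⇒ : surjective (j Vec.∷ Vec.map (punchIn j) u) ≡ true → ∀ i → hits u i ≡ true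
    ⇒ s i with hits⁻ (j Vec.∷ Vec.map (punchIn j) u) (surjective⁻ (j Vec.∷ Vec.map (punchIn j) u) s (punchIn j i))
    ... | zero , j≡i↑ = contradiction (sym j≡i↑) (Finₚ.punchInᵢ≢i j i)
    ... | suc x , ux↑≡i↑ = hits⁺ u x (Finₚ.punchIn-injective j _ _ (trans (sym (Vecₚ.lookup-map x (punchIn j) u)) ux↑≡i↑))
    ⇐ : surjective u ≡ true → ∀ i → hits (j Vec.∷ Vec.map (punchIn j) u) i ≡ true
    ⇐ s i = cover (j Fin.≟ i)
      where
      cover : Dec (j ≡ i) → hits (j Vec.∷ Vec.map (punchIn j) u) i ≡ true
      cover (yes j≡i) = hits⁺ (j Vec.∷ Vec.map (punchIn j) u) zero j≡i
      cover (no j≢i) = let x , ux≡i↓ = hits⁻ u (surjective⁻ u s (punchOut j≢i)) in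
        hits⁺ (j Vec.∷ Vec.map (punchIn j) u) (suc x)
          (trans (Vecₚ.lookup-map x (punchIn j) u) (trans (cong (punchIn j) ux≡i↓) (Finₚ.punchIn-punchOut j≢i)))

no-surjection : {n : ℕ} (τ : Vec (Fin (suc n)) n) → surjective τ ≡ false
no-surjection {n} τ with surjective τ in s
... | false = refl
... | true = contradiction (cong toℕ i≡j) (ℕₚ.<⇒≢ i<j)
  where
  preimage : Fin (suc n) → Fin n
  preimage v = proj₁ (hits⁻ τ (surjective⁻ τ s v))
  τ∘preimage : ∀ v → lookup τ (preimage v) ≡ v
  τ∘preimage v = proj₂ (hits⁻ τ (surjective⁻ τ s v))
  collision = Finₚ.pigeonhole (ℕₚ.n<1+n n) preimage
  i = proj₁ collision
  j = proj₁ (proj₂ collision)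
  i<j = proj₁ (proj₂ (proj₂ collision))
  i≡j : i ≡ j
  i≡j = trans (sym (τ∘preimage i)) (trans (cong (lookup τ) (proj₂ (proj₂ (proj₂ collision)))) (τ∘preimage j))

∑-allVecs-suc : {k n : ℕ} (F : Vec (Fin k) (suc n) → ℚ) →
  ∑ (allVecs k (suc n)) F ≡ ∑[ τ ← allVecs k n ] ∑[ j ← allFin k ] F (j Vec.∷ τ)
∑-allVecs-suc {k} {n} F = trans (∑-concatMap _ (allVecs k n) F) (∑-cong (allVecs k n) (λ τ → ∑-map (Vec._∷ τ) (allFin k) F))

∑-allFin-punchIn : {k : ℕ} (j : Fin (suc k)) (H : Fin (suc k) → ℚ) →
  ∑[ x ← allFin (suc k) ] [ not (x ==F j) ]· H x ≡ ∑[ x ← allFin k ] H (punchIn j x)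
∑-allFin-punchIn {k} zero H = trans (∑-allFin-suc (λ x → [ not (x ==F zero) ]· H x)) (ℚₚ.+-identityˡ _)
∑-allFin-punchIn {suc k} (suc j) H = begin
  ∑[ x ← allFin (suc (suc k)) ] [ not (x ==F suc j) ]· H x
    ≡⟨ ∑-allFin-suc (λ x → [ not (x ==F suc j) ]· H x) ⟩
  H zero + ∑[ x ← allFin (suc k) ] [ not (suc x ==F suc j) ]· H (suc x)
    ≡⟨ cong (H zero +_) (∑-cong (allFin (suc k)) (λ x → cong (λ b → [ not b ]· H (suc x)) (==F-suc x j))) ⟩
  H zero + ∑[ x ← allFin (suc k) ] [ not (x ==F j) ]· H (suc x)
    ≡⟨ cong (H zero +_) (∑-allFin-punchIn j (H ∘ suc)) ⟩
  H zero + ∑[ x ← allFin k ] H (suc (punchIn j x))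
    ≡⟨ ∑-allFin-suc (H ∘ punchIn (suc j)) ⟨
  ∑[ x ← allFin (suc k) ] H (punchIn (suc j) x) ∎
  where open ≡-Reasoning

∑-allVecs-punchIn : {k : ℕ} (n : ℕ) (j : Fin (suc k)) (F : Vec (Fin (suc k)) n → ℚ) →
  ∑[ τ ← allVecs (suc k) n ] [ not (hits τ j) ]· F τ ≡ ∑[ u ← allVecs k n ] F (Vec.map (punchIn j) u)
∑-allVecs-punchIn zero j F = refl
∑-allVecs-punchIn {k} (suc n) j F = begin
  ∑[ τ ← allVecs (suc k) (suc n) ] [ not (hits τ j) ]· F τ
    ≡⟨ ∑-allVecs-suc (λ τ → [ not (hits τ j) ]· F τ) ⟩
  ∑[ τ ← allVecs (suc k) n ] ∑[ x ← allFin (suc k) ] [ not (hits (x Vec.∷ τ) j) ]· F (x Vec.∷ τ)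
    ≡⟨ ∑-cong (allVecs (suc k) n) (λ τ → trans (∑-cong (allFin (suc k)) (λ x →
         trans (cong (λ b → [ not b ]· F (x Vec.∷ τ)) (hits-∷ x τ j)) ([]·-nor (x ==F j) (hits τ j) _)))
         (∑-[]· (allFin (suc k)) (not (hits τ j)) _)) ⟩
  ∑[ τ ← allVecs (suc k) n ] [ not (hits τ j) ]· ∑[ x ← allFin (suc k) ] [ not (x ==F j) ]· F (x Vec.∷ τ)
    ≡⟨ ∑-allVecs-punchIn n j _ ⟩
  ∑[ u ← allVecs k n ] ∑[ x ← allFin (suc k) ] [ not (x ==F j) ]· F (x Vec.∷ Vec.map (punchIn j) u)
    ≡⟨ ∑-cong (allVecs k n) (λ u → ∑-allFin-punchIn j _) ⟩
  ∑[ u ← allVecs k n ] ∑[ x ← allFin k ] F (punchIn j x Vec.∷ Vec.map (punchIn j) u)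
    ≡⟨ ∑-allVecs-suc (F ∘ Vec.map (punchIn j)) ⟨
  ∑[ u ← allVecs k (suc n) ] F (Vec.map (punchIn j) u) ∎
  where open ≡-Reasoning

-- Sums over order-preserving surjections

opSurjective : {n k : ℕ} → Poset n → Vec (Fin k) n → Bool
opSurjective P σ = orderPreserving P σ ∧ surjective σ

∑Surj : {n : ℕ} → Poset n → ({k : ℕ} → Vec (Fin k) n → ℚ) → ℚ
∑Surj {n} P F = ∑[ k ← upTo (suc n) ] ∑[ σ ← allVecs k n ] [ opSurjective P σ ]· F σ

∑Surj-cong : {n : ℕ} (P : Poset n) {F G : {k : ℕ} → Vec (Fin k) n → ℚ} →
  (∀ {k} (σ : Vec (Fin k) n) → F σ ≡ G σ) → ∑Surj P F ≡ ∑Surj P G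
∑Surj-cong {n} P F≗G = ∑-cong (upTo (suc n)) (λ k → ∑-cong (allVecs k n) (λ σ → cong ([ opSurjective P σ ]·_) (F≗G σ)))

∑Surj-sub-[]· : {n : ℕ} (P : Poset n) (b : Bool) (F G : {k : ℕ} → Vec (Fin k) n → ℚ) →
  ∑Surj P (λ σ → F σ - [ b ]· G σ) ≡ ∑Surj P F - [ b ]· ∑Surj P G
∑Surj-sub-[]· {n} P b F G = begin
  ∑Surj P (λ σ → F σ - [ b ]· G σ)
    ≡⟨ ∑-cong (upTo (suc n)) (λ k → ∑-cong (allVecs k n) (λ σ → guard (opSurjective P σ) (F σ) (G σ))) ⟩
  ∑[ k ← upTo (suc n) ] ∑[ σ ← allVecs k n ] ([ opSurjective P σ ]· F σ - [ b ]· [ opSurjective P σ ]· G σ)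
    ≡⟨ ∑-cong (upTo (suc n)) (λ k → ∑-sub-[]· (allVecs k n) b (λ σ → [ opSurjective P σ ]· F σ) (λ σ → [ opSurjective P σ ]· G σ)) ⟩
  ∑[ k ← upTo (suc n) ] (level F k - [ b ]· level G k)
    ≡⟨ ∑-sub-[]· (upTo (suc n)) b (level F) (level G) ⟩
  ∑Surj P F - [ b ]· ∑Surj P G ∎
  where
  open ≡-Reasoning
  level : ({k : ℕ} → Vec (Fin k) n → ℚ) → ℕ → ℚ
  level H k = ∑[ σ ← allVecs k n ] [ opSurjective P σ ]· H σ
  guard : ∀ c x y → [ c ]· (x - [ b ]· y) ≡ [ c ]· x - [ b ]· [ c ]· y
  guard c x y = trans ([]·-+ c x _) (cong ([ c ]· x +_) (trans ([]·-neg c _) (cong -_ ([]·-comm c b y))))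

⟦⟧-∑ : (f : LinFun) (v : QSym) → ⟦ f ⟧ v ≡ ∑[ cα ← v ] (proj₁ cα * f (proj₂ cα))
⟦⟧-∑ f [] = refl
⟦⟧-∑ f ((c , α) ∷ v) = cong (c * f α +_) (⟦⟧-∑ f v)

⟦⟧-K : {n : ℕ} (f : LinFun) (P : Poset n) → ⟦ f ⟧ (K P) ≡ ∑Surj P (λ σ → f (fibreType σ))
⟦⟧-K {n} f P = begin
  ⟦ f ⟧ (K P)
    ≡⟨ ⟦⟧-∑ f (K P) ⟩
  ∑ (K P) term
    ≡⟨ ∑-concatMap (λ k → map (λ σ → (1ℚ , fibreType σ)) (filterᵇ (opSurjective P) (allVecs k n))) (upTo (suc n)) term ⟩
  ∑[ k ← upTo (suc n) ] ∑ (map (λ σ → (1ℚ , fibreType σ)) (filterᵇ (opSurjective P) (allVecs k n))) term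
    ≡⟨ ∑-cong (upTo (suc n)) (λ k → trans (∑-map (λ σ → (1ℚ , fibreType σ)) (filterᵇ (opSurjective P) (allVecs k n)) term)
         (trans (∑-filterᵇ (opSurjective P) (allVecs k n) (λ σ → 1ℚ * f (fibreType σ)))
                (∑-cong (allVecs k n) (λ σ → cong ([ opSurjective P σ ]·_) (ℚₚ.*-identityˡ (f (fibreType σ))))))) ⟩
  ∑Surj P (λ σ → f (fibreType σ)) ∎
  where
  open ≡-Reasoning
  term : ℚ × Composition → ℚ
  term (c , α) = c * f α

module _ {n k : ℕ} (σ : Vec (Fin k) n) where

  length-fibreType : length (fibreType σ) ≡ k
  length-fibreType = trans (Listₚ.length-map _ (allFin k)) (Listₚ.length-tabulate id)

  sum-fibreType : sum (fibreType σ) ≡ n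
  sum-fibreType = trans (sum-counts (allFin n)) (Listₚ.length-tabulate id)
    where
    count : List (Fin n) → Fin k → ℕ
    count xs j = countᵇ (λ x → lookup σ x ==F j) xs
    sum-counts : (xs : List (Fin n)) → sum (map (count xs) (allFin k)) ≡ length xs
    sum-counts [] = sum-zeros (allFin k) {count []} (λ _ → refl)
    sum-counts (x ∷ xs) = begin
      sum (map (count (x ∷ xs)) (allFin k))
        ≡⟨ cong sum (Listₚ.map-cong (λ j → if-suc (lookup σ x ==F j) (count xs j)) (allFin k)) ⟩
      sum (map (λ j → fromBool (lookup σ x ==F j) ℕ.+ count xs j) (allFin k))
        ≡⟨ sum-map-+ (λ j → fromBool (lookup σ x ==F j)) (count xs) (allFin k) ⟩
      sum (map (λ j → fromBool (lookup σ x ==F j)) (allFin k)) ℕ.+ sum (map (count xs) (allFin k))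
        ≡⟨ cong₂ ℕ._+_ (sum-indicators (lookup σ x)) (sum-counts xs) ⟩
      suc (length xs) ∎
      where
      open ≡-Reasoning
      if-suc : ∀ b c → (if b then suc c else c) ≡ fromBool b ℕ.+ c
      if-suc true c = refl
      if-suc false c = refl

-- F summed over the order-preserving maps σ of P that restrict on P ∖ 0 to u,
-- either directly (σ = j ∷ u) or after deleting the value j taken by 0 alone
-- (σ = j ∷ punchIn j ∘ u). Every order-preserving surjection of P arises
-- exactly once this way from an order-preserving surjection u of P ∖ 0.
extensionSum : {n : ℕ} → Poset (suc n) → ({k : ℕ} → Vec (Fin k) (suc n) → ℚ) → {k : ℕ} → Vec (Fin k) n → ℚ
extensionSum P F {k} u =
  ∑[ j ← allFin k ] [ extendableAt P (toℕ j) u ]· F (j Vec.∷ u)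
  + ∑[ j ← allFin (suc k) ] [ extendableAt P (toℕ j) u ]· F (j Vec.∷ Vec.map (punchIn j) u)

module _ {n : ℕ} (P : Poset (suc n)) (nl : NaturallyLabeled P) (F : {k : ℕ} → Vec (Fin k) (suc n) → ℚ) where

  private
    P⁻ = deleteZero P

    ext : {m k : ℕ} → Fin m → Vec (Fin k) n → Bool
    ext j u = extendableAt P (toℕ j) u

    G : {k : ℕ} → Fin k → Vec (Fin k) n → ℚ
    G j τ = [ (ext j τ ∧ orderPreserving P⁻ τ) ∧ surjective (j Vec.∷ τ) ]· F (j Vec.∷ τ)

    repeated fresh : ℕ → ℚ
    repeated k = ∑[ u ← allVecs k n ] [ opSurjective P⁻ u ]· ∑[ j ← allFin k ] [ ext j u ]· F (j Vec.∷ u)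
    fresh k = ∑[ τ ← allVecs k n ] ∑[ j ← allFin k ] [ not (hits τ j) ]· G j τ

    level-split : ∀ k → ∑[ σ ← allVecs k (suc n) ] [ opSurjective P σ ]· F σ ≡ repeated k + fresh k
    level-split k = begin
      ∑[ σ ← allVecs k (suc n) ] [ opSurjective P σ ]· F σ
        ≡⟨ ∑-allVecs-suc (λ σ → [ opSurjective P σ ]· F σ) ⟩
      ∑[ τ ← allVecs k n ] ∑[ j ← allFin k ] [ opSurjective P (j Vec.∷ τ) ]· F (j Vec.∷ τ)
        ≡⟨ ∑-cong (allVecs k n) (λ τ → ∑-cong (allFin k) (λ j →
             trans (cong (λ b → [ b ∧ surjective (j Vec.∷ τ) ]· F (j Vec.∷ τ)) (orderPreserving-∷ P nl j τ))
                   ([]·-surjective-∷ j τ (ext j τ ∧ orderPreserving P⁻ τ) (F (j Vec.∷ τ))))) ⟩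
      ∑[ τ ← allVecs k n ] ∑[ j ← allFin k ] (R j τ + [ not (hits τ j) ]· G j τ)
        ≡⟨ ∑-cong (allVecs k n) (λ τ → ∑-+ (allFin k) (λ j → R j τ) (λ j → [ not (hits τ j) ]· G j τ)) ⟩
      ∑[ τ ← allVecs k n ] (∑[ j ← allFin k ] R j τ + ∑[ j ← allFin k ] [ not (hits τ j) ]· G j τ)
        ≡⟨ ∑-+ (allVecs k n) (λ τ → ∑[ j ← allFin k ] R j τ) (λ τ → ∑[ j ← allFin k ] [ not (hits τ j) ]· G j τ) ⟩
      ∑[ τ ← allVecs k n ] ∑[ j ← allFin k ] R j τ + fresh k
        ≡⟨ cong (_+ fresh k) (∑-cong (allVecs k n) (λ τ →
             trans (∑-cong (allFin k) (λ j → []·-∧-∧ (ext j τ) (orderPreserving P⁻ τ) (surjective τ) (F (j Vec.∷ τ))))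
                   (∑-[]· (allFin k) (opSurjective P⁻ τ) (λ j → [ ext j τ ]· F (j Vec.∷ τ))))) ⟩
      repeated k + fresh k ∎
      where
      open ≡-Reasoning
      R : Fin k → Vec (Fin k) n → ℚ
      R j τ = [ (ext j τ ∧ orderPreserving P⁻ τ) ∧ surjective τ ]· F (j Vec.∷ τ)

    fresh-zero : fresh 0 ≡ 0ℚ
    fresh-zero = ∑-zero (allVecs 0 n)

    fresh-suc : ∀ k → fresh (suc k) ≡
      ∑[ u ← allVecs k n ] [ opSurjective P⁻ u ]· ∑[ j ← allFin (suc k) ] [ ext j u ]· F (j Vec.∷ Vec.map (punchIn j) u)
    fresh-suc k = begin
      fresh (suc k)
        ≡⟨ ∑-comm (allVecs (suc k) n) (allFin (suc k)) (λ τ j → [ not (hits τ j) ]· G j τ) ⟩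
      ∑[ j ← allFin (suc k) ] ∑[ τ ← allVecs (suc k) n ] [ not (hits τ j) ]· G j τ
        ≡⟨ ∑-cong (allFin (suc k)) (λ j → ∑-allVecs-punchIn n j (G j)) ⟩
      ∑[ j ← allFin (suc k) ] ∑[ u ← allVecs k n ] G j (Vec.map (punchIn j) u)
        ≡⟨ ∑-cong (allFin (suc k)) (λ j → ∑-cong (allVecs k n) (G-punchIn j)) ⟩
      ∑[ j ← allFin (suc k) ] ∑[ u ← allVecs k n ] [ opSurjective P⁻ u ]· H j u
        ≡⟨ ∑-comm (allFin (suc k)) (allVecs k n) (λ j u → [ opSurjective P⁻ u ]· H j u) ⟩
      ∑[ u ← allVecs k n ] ∑[ j ← allFin (suc k) ] [ opSurjective P⁻ u ]· H j u
        ≡⟨ ∑-cong (allVecs k n) (λ u → ∑-[]· (allFin (suc k)) (opSurjective P⁻ u) (λ j → H j u)) ⟩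
      ∑[ u ← allVecs k n ] [ opSurjective P⁻ u ]· ∑[ j ← allFin (suc k) ] H j u ∎
      where
      open ≡-Reasoning
      H : Fin (suc k) → Vec (Fin k) n → ℚ
      H j u = [ ext j u ]· F (j Vec.∷ Vec.map (punchIn j) u)
      G-punchIn : ∀ j u → G j (Vec.map (punchIn j) u) ≡ [ opSurjective P⁻ u ]· H j u
      G-punchIn j u = begin
        G j (Vec.map (punchIn j) u)
          ≡⟨ cong₂ (λ a b → [ a ∧ b ]· F (j Vec.∷ Vec.map (punchIn j) u))
               (cong₂ _∧_ (extendableAt-punchIn j P u) (orderPreserving-punchIn j P⁻ u)) (surjective-∷-punchIn j u) ⟩
        [ (ext j u ∧ orderPreserving P⁻ u) ∧ surjective u ]· F (j Vec.∷ Vec.map (punchIn j) u)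
          ≡⟨ []·-∧-∧ (ext j u) (orderPreserving P⁻ u) (surjective u) _ ⟩
        [ opSurjective P⁻ u ]· H j u ∎

    repeated-top : repeated (suc n) ≡ 0ℚ
    repeated-top = trans (∑-cong (allVecs (suc n) n) vanish) (∑-zero (allVecs (suc n) n))
      where
      vanish : (u : Vec (Fin (suc n)) n) → [ opSurjective P⁻ u ]· ∑[ j ← allFin (suc n) ] [ ext j u ]· F (j Vec.∷ u) ≡ 0ℚ
      vanish u rewrite no-surjection u | ∧-zeroʳ (orderPreserving P⁻ u) = refl

  ∑Surj-deleteZero : ∑Surj P F ≡ ∑Surj (deleteZero P) (extensionSum P F)
  ∑Surj-deleteZero = begin
    ∑Surj P F
      ≡⟨ ∑-cong (upTo (suc (suc n))) level-split ⟩
    ∑[ k ← upTo (suc (suc n)) ] (repeated k + fresh k)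
      ≡⟨ ∑-+ (upTo (suc (suc n))) repeated fresh ⟩
    ∑ (upTo (suc (suc n))) repeated + ∑ (upTo (suc (suc n))) fresh
      ≡⟨ cong₂ _+_ (∑-upTo-∷ʳ (suc n) repeated) (∑-upTo-suc (suc n) fresh) ⟩
    (∑ (upTo (suc n)) repeated + repeated (suc n)) + (fresh 0 + ∑ (upTo (suc n)) (fresh ∘ suc))
      ≡⟨ cong₂ (λ a b → (∑ (upTo (suc n)) repeated + a) + (b + ∑ (upTo (suc n)) (fresh ∘ suc))) repeated-top fresh-zero ⟩
    (∑ (upTo (suc n)) repeated + 0ℚ) + (0ℚ + ∑ (upTo (suc n)) (fresh ∘ suc))
      ≡⟨ cong₂ _+_ (ℚₚ.+-identityʳ (∑ (upTo (suc n)) repeated)) (ℚₚ.+-identityˡ (∑ (upTo (suc n)) (fresh ∘ suc))) ⟩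
    ∑ (upTo (suc n)) repeated + ∑ (upTo (suc n)) (fresh ∘ suc)
      ≡⟨ ∑-+ (upTo (suc n)) repeated (fresh ∘ suc) ⟨
    ∑[ k ← upTo (suc n) ] (repeated k + fresh (suc k))
      ≡⟨ ∑-cong (upTo (suc n)) (λ k → trans (cong (repeated k +_) (fresh-suc k))
           (sym (∑-+ (allVecs k n) (λ u → [ opSurjective P⁻ u ]· E₁ u) (λ u → [ opSurjective P⁻ u ]· E₂ u)))) ⟩
    ∑[ k ← upTo (suc n) ] ∑[ u ← allVecs k n ] ([ opSurjective P⁻ u ]· E₁ u + [ opSurjective P⁻ u ]· E₂ u)
      ≡⟨ ∑-cong (upTo (suc n)) (λ k → ∑-cong (allVecs k n) (λ u → sym ([]·-+ (opSurjective P⁻ u) (E₁ u) (E₂ u)))) ⟩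
    ∑Surj (deleteZero P) (extensionSum P F) ∎
    where
    open ≡-Reasoning
    E₁ E₂ : {k : ℕ} → Vec (Fin k) n → ℚ
    E₁ {k} u = ∑[ j ← allFin k ] [ ext j u ]· F (j Vec.∷ u)
    E₂ {k} u = ∑[ j ← allFin (suc k) ] [ ext j u ]· F (j Vec.∷ Vec.map (punchIn j) u)

-- Weights and iterated differences

δ : (ℕ → ℚ) → ℕ → ℚ
δ h d = h d - h (suc d)

δ^ : ℕ → (ℕ → ℚ) → ℕ → ℚ
δ^ zero h = h
δ^ (suc m) h = δ (δ^ m h)

δ^-suc : (m : ℕ) (h : ℕ → ℚ) (d : ℕ) → δ^ (suc m) h d ≡ δ^ m (δ h) d
δ^-suc zero h d = refl
δ^-suc (suc m) h d = cong₂ _-_ (δ^-suc m h d) (δ^-suc m h (suc d))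

δ^-cong : (m : ℕ) {g h : ℕ → ℚ} → (∀ d → g d ≡ h d) → ∀ d → δ^ m g d ≡ δ^ m h d
δ^-cong zero g≗h d = g≗h d
δ^-cong (suc m) g≗h d = cong₂ _-_ (δ^-cong m g≗h d) (δ^-cong m g≗h (suc d))

δ^-zero : (m d : ℕ) → δ^ m (λ _ → 0ℚ) d ≡ 0ℚ
δ^-zero zero d = refl
δ^-zero (suc m) d = cong₂ _-_ (δ^-zero m d) (δ^-zero m (suc d))

-- (-1)ʳ C(d, r), by Pascal's rule
signedBinomial : ℕ → ℕ → ℚ
signedBinomial zero d = 1ℚ
signedBinomial (suc r) zero = 0ℚ
signedBinomial (suc r) (suc d) = signedBinomial (suc r) d - signedBinomial r d

δ-signedBinomial : (r d : ℕ) → δ (signedBinomial (suc r)) d ≡ signedBinomial r d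
δ-signedBinomial r d = x-[x-y]≡y (signedBinomial (suc r) d) (signedBinomial r d)
  where
  x-[x-y]≡y : ∀ x y → x - (x - y) ≡ y
  x-[x-y]≡y = solve 2 (λ x y → x :- (x :- y) := y) refl

δ^-signedBinomial : (m r : ℕ) → δ^ m (signedBinomial r) 0 ≡ indicator m r
δ^-signedBinomial zero zero = refl
δ^-signedBinomial zero (suc r) = refl
δ^-signedBinomial (suc m) zero = trans (δ^-suc m (signedBinomial zero) 0) (δ^-zero m 0)
δ^-signedBinomial (suc m) (suc r) =
  trans (δ^-suc m (signedBinomial (suc r)) 0) (trans (δ^-cong m (δ-signedBinomial r) 0) (δ^-signedBinomial m r))

sign : ℕ → ℚ
sign zero = 1ℚ
sign (suc m) = - sign m

weight : (ℕ → ℚ) → ℕ → ℕ → ℕ → ℚ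
weight h N zero a = h N
weight h N (suc ℓ) a = sign (suc ℓ) * (h N - h (N ∸ a))

firstFibre : {n k : ℕ} → Vec (Fin k) n → ℕ
firstFibre {k = zero} σ = 0
firstFibre {n} {suc k} σ = countᵇ (λ x → lookup σ x ==F zero) (allFin n)

fibreWeight : (ℕ → ℚ) → ℕ → {n k : ℕ} → Vec (Fin k) n → ℚ
fibreWeight h N {k = k} σ = weight h N k (firstFibre σ)

module _ {n k : ℕ} where

  firstFibre-zero∷ : (u : Vec (Fin (suc k)) n) → firstFibre (zero Vec.∷ u) ≡ suc (firstFibre u)
  firstFibre-zero∷ u = countᵇ-allFin-suc (λ x → lookup (zero Vec.∷ u) x ==F zero)

  firstFibre-suc∷ : (j : Fin k) (u : Vec (Fin (suc k)) n) → firstFibre (suc j Vec.∷ u) ≡ firstFibre u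
  firstFibre-suc∷ j u = countᵇ-allFin-suc (λ x → lookup (suc j Vec.∷ u) x ==F zero)

  firstFibre-punchIn-zero : (u : Vec (Fin k) n) → firstFibre (Vec.map (punchIn zero) u) ≡ 0
  firstFibre-punchIn-zero u = countᵇ-none (allFin n) (λ x → cong (_==F zero) (Vecₚ.lookup-map x (punchIn zero) u))

  firstFibre-punchIn-suc : (j : Fin (suc k)) (u : Vec (Fin (suc k)) n) → firstFibre (Vec.map (punchIn (suc j)) u) ≡ firstFibre u
  firstFibre-punchIn-suc j u = countᵇ-cong (allFin n) (λ x →
    trans (cong (_==F zero) (Vecₚ.lookup-map x (punchIn (suc j)) u)) (zero-kept (lookup u x)))
    where
    zero-kept : (w : Fin (suc k)) → (punchIn (suc j) w ==F zero) ≡ (w ==F zero)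
    zero-kept zero = refl
    zero-kept (suc w) = refl

module _ (h : ℕ → ℚ) (N : ℕ) {n : ℕ} (P : Poset (suc n)) where

  module _ {k : ℕ} (u : Vec (Fin (suc k)) n) where

    keptExtensions-fibreWeight :
      ∑[ j ← allFin (suc k) ] [ extendableAt P (toℕ j) u ]· fibreWeight h N (j Vec.∷ u)
        ≡ sign (suc k) * (h N - h (N ∸ suc (firstFibre u)))
          + ∑[ t ← allFin k ] [ extendableAt P (suc (toℕ t)) u ]· fibreWeight h N u
    keptExtensions-fibreWeight = trans (∑-allFin-suc (λ j → [ extendableAt P (toℕ j) u ]· fibreWeight h N (j Vec.∷ u))) (cong₂ _+_
      (cong₂ (λ b m → [ b ]· (sign (suc k) * (h N - h (N ∸ m)))) (extendableAt-zero P u) (firstFibre-zero∷ u))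
      (∑-cong (allFin k) (λ t → cong (λ m → [ extendableAt P (suc (toℕ t)) u ]· weight h N (suc k) m) (firstFibre-suc∷ t u))))

    punchedExtensions-fibreWeight :
      ∑[ j ← allFin (suc (suc k)) ] [ extendableAt P (toℕ j) u ]· fibreWeight h N (j Vec.∷ Vec.map (punchIn j) u)
        ≡ - sign (suc k) * (h N - h (N ∸ 1))
          + - (∑[ t ← allFin k ] [ extendableAt P (suc (toℕ t)) u ]· fibreWeight h N u + [ isMaximal P zero ]· fibreWeight h N u)
    punchedExtensions-fibreWeight = trans (∑-allFin-suc (λ j → [ extendableAt P (toℕ j) u ]· fibreWeight h N (j Vec.∷ Vec.map (punchIn j) u)))
      (cong₂ _+_ new-least (begin
      ∑[ t ← allFin (suc k) ] [ extendableAt P (suc (toℕ t)) u ]· fibreWeight h N (suc t Vec.∷ Vec.map (punchIn (suc t)) u)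
        ≡⟨ ∑-cong (allFin (suc k)) (λ t → trans
             (cong (λ m → [ extendableAt P (suc (toℕ t)) u ]· (- sign (suc k) * (h N - h (N ∸ m))))
                   (trans (firstFibre-suc∷ t (Vec.map (punchIn (suc t)) u)) (firstFibre-punchIn-suc t u)))
             (trans (cong ([ extendableAt P (suc (toℕ t)) u ]·_) (sym (ℚₚ.neg-distribˡ-* (sign (suc k)) _)))
                    ([]·-neg (extendableAt P (suc (toℕ t)) u) (fibreWeight h N u)))) ⟩
      ∑[ t ← allFin (suc k) ] (- c (toℕ t))
        ≡⟨ ∑-neg (allFin (suc k)) (c ∘ toℕ) ⟩
      - ∑ (allFin (suc k)) (c ∘ toℕ)
        ≡⟨ cong -_ (trans (∑-allFin-toℕ-∷ʳ k c)
             (cong (∑ (allFin k) (c ∘ toℕ) +_) (cong (λ b → [ b ]· fibreWeight h N u) (extendableAt-top P u)))) ⟩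
      - (∑ (allFin k) (c ∘ toℕ) + [ isMaximal P zero ]· fibreWeight h N u) ∎))
      where
      open ≡-Reasoning
      c : ℕ → ℚ
      c t = [ extendableAt P (suc t) u ]· fibreWeight h N u
      new-least : [ extendableAt P 0 u ]· fibreWeight h N (zero Vec.∷ Vec.map (punchIn zero) u) ≡ - sign (suc k) * (h N - h (N ∸ 1))
      new-least = cong₂ (λ b m → [ b ]· (- sign (suc k) * (h N - h (N ∸ m)))) (extendableAt-zero P u)
        (trans (firstFibre-zero∷ (Vec.map (punchIn zero) u)) (cong suc (firstFibre-punchIn-zero u)))

  extensionSum-fibreWeight : {k : ℕ} (u : Vec (Fin k) n) →
    extensionSum P (fibreWeight h N) u ≡ fibreWeight h (N ∸ 1) u - [ isMaximal P zero ]· fibreWeight h N u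
  extensionSum-fibreWeight {zero} u = begin
    0ℚ + ([ extendableAt P 0 u ]· fibreWeight h N (zero Vec.∷ Vec.map (punchIn zero) u) + 0ℚ)
      ≡⟨ cong₂ (λ b a → 0ℚ + ([ b ]· weight h N 1 a + 0ℚ)) (extendableAt-zero P u)
               (trans (firstFibre-zero∷ (Vec.map (punchIn zero) u)) (cong suc (firstFibre-punchIn-zero u))) ⟩
    0ℚ + (- 1ℚ * (h N - h (N ∸ 1)) + 0ℚ)
      ≡⟨ telescope (h N) (h (N ∸ 1)) ⟩
    h (N ∸ 1) - h N
      ≡⟨ cong (λ b → h (N ∸ 1) - [ b ]· h N) (trans (sym (extendableAt-zero P u)) (extendableAt-top P u)) ⟩
    h (N ∸ 1) - [ isMaximal P zero ]· h N ∎
    where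
    open ≡-Reasoning
    telescope : ∀ x y → 0ℚ + (- 1ℚ * (x - y) + 0ℚ) ≡ y - x
    telescope = solve 2 (λ x y → con 0ℚ :+ (:- con 1ℚ :* (x :- y) :+ con 0ℚ) := y :- x) refl
  extensionSum-fibreWeight {suc k} u = begin
    extensionSum P (fibreWeight h N) u
      ≡⟨ cong₂ _+_ (keptExtensions-fibreWeight u) (punchedExtensions-fibreWeight u) ⟩
    (s * (h N - h (N ∸ suc a)) + S) + (- s * (h N - h (N ∸ 1)) + - (S + [ isMaximal P zero ]· fibreWeight h N u))
      ≡⟨ telescope s (h N) (h (N ∸ 1)) (h (N ∸ suc a)) S ([ isMaximal P zero ]· fibreWeight h N u) ⟩
    s * (h (N ∸ 1) - h (N ∸ suc a)) - [ isMaximal P zero ]· fibreWeight h N u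
      ≡⟨ cong (λ m → s * (h (N ∸ 1) - h m) - [ isMaximal P zero ]· fibreWeight h N u) (sym (ℕₚ.∸-+-assoc N 1 a)) ⟩
    fibreWeight h (N ∸ 1) u - [ isMaximal P zero ]· fibreWeight h N u ∎
    where
    open ≡-Reasoning
    s = sign (suc k)
    a = firstFibre u
    S = ∑[ t ← allFin k ] [ extendableAt P (suc (toℕ t)) u ]· fibreWeight h N u
    telescope : ∀ s x y z S C → (s * (x - z) + S) + (- s * (x - y) + - (S + C)) ≡ s * (y - z) - C
    telescope = solve 6 (λ s x y z S C → (s :* (x :- z) :+ S) :+ (:- s :* (x :- y) :+ :- (S :+ C)) := s :* (y :- z) :- C) refl

module _ (h : ℕ → ℚ) where

  ∑Surj-fibreWeight-deleteZero : {n : ℕ} (P : Poset (suc n)) → NaturallyLabeled P → (N : ℕ) →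
    ∑Surj P (fibreWeight h N)
      ≡ ∑Surj (deleteZero P) (fibreWeight h (N ∸ 1)) - [ isMaximal P zero ]· ∑Surj (deleteZero P) (fibreWeight h N)
  ∑Surj-fibreWeight-deleteZero P nl N = begin
    ∑Surj P (fibreWeight h N)
      ≡⟨ ∑Surj-deleteZero P nl (fibreWeight h N) ⟩
    ∑Surj (deleteZero P) (extensionSum P (fibreWeight h N))
      ≡⟨ ∑Surj-cong (deleteZero P) (extensionSum-fibreWeight h N P) ⟩
    ∑Surj (deleteZero P) (λ u → fibreWeight h (N ∸ 1) u - [ isMaximal P zero ]· fibreWeight h N u)
      ≡⟨ ∑Surj-sub-[]· (deleteZero P) (isMaximal P zero) (fibreWeight h (N ∸ 1)) (fibreWeight h N) ⟩
    ∑Surj (deleteZero P) (fibreWeight h (N ∸ 1)) - [ isMaximal P zero ]· ∑Surj (deleteZero P) (fibreWeight h N) ∎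
    where open ≡-Reasoning

  ∑Surj-fibreWeight : (n : ℕ) (P : Poset n) → NaturallyLabeled P → (d : ℕ) →
    ∑Surj P (fibreWeight h (d ℕ.+ n)) ≡ δ^ (numMaximal P) h d
  ∑Surj-fibreWeight zero P nl d rewrite ℕₚ.+-identityʳ d = trans (ℚₚ.+-identityʳ _) (ℚₚ.+-identityʳ _)
  ∑Surj-fibreWeight (suc n) P nl d rewrite ℕₚ.+-suc d n = begin
    ∑Surj P (fibreWeight h (suc (d ℕ.+ n)))
      ≡⟨ ∑Surj-fibreWeight-deleteZero P nl (suc (d ℕ.+ n)) ⟩
    ∑Surj P⁻ (fibreWeight h (d ℕ.+ n)) - [ isMaximal P zero ]· ∑Surj P⁻ (fibreWeight h (suc d ℕ.+ n))
      ≡⟨ cong₂ (λ x y → x - [ isMaximal P zero ]· y) (induction d) (induction (suc d)) ⟩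
    δ^ m h d - [ isMaximal P zero ]· δ^ m h (suc d)
      ≡⟨ step (isMaximal P zero) ⟩
    δ^ (if isMaximal P zero then suc m else m) h d
      ≡⟨ cong (λ m → δ^ m h d) (numMaximal-deleteZero P nl) ⟨
    δ^ (numMaximal P) h d ∎
    where
    open ≡-Reasoning
    P⁻ = deleteZero P
    m = numMaximal P⁻
    induction : ∀ d → ∑Surj P⁻ (fibreWeight h (d ℕ.+ n)) ≡ δ^ m h d
    induction = ∑Surj-fibreWeight n P⁻ (NaturallyLabeled-deleteZero P nl)
    step : ∀ b → δ^ m h d - [ b ]· δ^ m h (suc d) ≡ δ^ (if b then suc m else m) h d
    step true = refl
    step false = ℚₚ.+-identityʳ _

firstPart : Composition → ℕ
firstPart [] = 0
firstPart (a ∷ _) = a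

maxFunctional : (ℕ → ℚ) → LinFun
maxFunctional h α = weight h (sum α) (length α) (firstPart α)

maxFunctional-fibreType : (h : ℕ → ℚ) {n k : ℕ} (σ : Vec (Fin k) n) → maxFunctional h (fibreType σ) ≡ fibreWeight h n σ
maxFunctional-fibreType h {k = zero} σ = cong₂ (λ N ℓ → weight h N ℓ 0) (sum-fibreType σ) (length-fibreType σ)
maxFunctional-fibreType h {k = suc k} σ = cong₂ (λ N ℓ → weight h N ℓ (firstFibre σ)) (sum-fibreType σ) (length-fibreType σ)

maxFunctional-K : (i : ℕ) {n : ℕ} (P : Poset n) → NaturallyLabeled P →
  ⟦ maxFunctional (signedBinomial i) ⟧ (K P) ≡ indicator (numMaximal P) i
maxFunctional-K i {n} P nl = begin
  ⟦ maxFunctional h ⟧ (K P)                       ≡⟨ ⟦⟧-K (maxFunctional h) P ⟩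
  ∑Surj P (λ σ → maxFunctional h (fibreType σ))   ≡⟨ ∑Surj-cong P (maxFunctional-fibreType h) ⟩
  ∑Surj P (fibreWeight h n)                       ≡⟨ ∑Surj-fibreWeight h n P nl 0 ⟩
  δ^ (numMaximal P) h 0                           ≡⟨ δ^-signedBinomial (numMaximal P) i ⟩
  indicator (numMaximal P) i                      ∎
  where
  open ≡-Reasoning
  h = signedBinomial i

-- Duality

dual : {n : ℕ} → Poset n → Poset n
dual P = record
  { rel = λ x y → rel P (opposite y) (opposite x)
  ; reflex = λ x → reflex P (opposite x)
  ; antisym = λ x y x⪯y y⪯x → trans (sym (Finₚ.opposite-involutive x))
      (trans (cong opposite (antisym P (opposite x) (opposite y) y⪯x x⪯y)) (Finₚ.opposite-involutive y))
  ; transit = λ x y z x⪯y y⪯z → transit P (opposite z) (opposite y) (opposite x) y⪯z x⪯y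
  }

module _ {n : ℕ} (P : Poset n) where

  NaturallyLabeled-dual : NaturallyLabeled P → NaturallyLabeled (dual P)
  NaturallyLabeled-dual nl x y x⪯y = opposite-≤⁻ y x (nl (opposite y) (opposite x) x⪯y)

  isMaximal-dual : (x : Fin n) → isMaximal (dual P) x ≡ isMinimal P (opposite x)
  isMaximal-dual x = begin
    isMaximal (dual P) x
      ≡⟨ all-cong (allFin n) (λ y → cong (not (rel P (opposite y) (opposite x)) ∨_)
           (sym (trans (opposite-==F y (opposite x)) (cong (y ==F_) (Finₚ.opposite-involutive x))))) ⟩
    all ((λ y → not (rel P y (opposite x)) ∨ (y ==F opposite x)) ∘ opposite) (allFin n)
      ≡⟨ all-opposite (λ y → not (rel P y (opposite x)) ∨ (y ==F opposite x)) ⟩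
    isMinimal P (opposite x) ∎
    where open ≡-Reasoning

  numMaximal-dual : numMaximal (dual P) ≡ numMinimal P
  numMaximal-dual = trans (countᵇ-cong (allFin n) isMaximal-dual) (countᵇ-opposite (isMinimal P))

lookup-∷ʳ-fromℕ : {n : ℕ} (xs : Vec A n) (y : A) → lookup (xs Vec.∷ʳ y) (fromℕ n) ≡ y
lookup-∷ʳ-fromℕ Vec.[] y = refl
lookup-∷ʳ-fromℕ (x Vec.∷ xs) y = lookup-∷ʳ-fromℕ xs y

lookup-∷ʳ-inject₁ : {n : ℕ} (xs : Vec A n) (y : A) (i : Fin n) → lookup (xs Vec.∷ʳ y) (inject₁ i) ≡ lookup xs i
lookup-∷ʳ-inject₁ (x Vec.∷ xs) y zero = refl
lookup-∷ʳ-inject₁ (x Vec.∷ xs) y (suc i) = lookup-∷ʳ-inject₁ xs y i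

lookup-reverse : {n : ℕ} (xs : Vec A n) (i : Fin n) → lookup (Vec.reverse xs) (opposite i) ≡ lookup xs i
lookup-reverse (x Vec.∷ xs) zero =
  trans (cong (λ v → lookup v (opposite zero)) (Vecₚ.reverse-∷ x xs)) (lookup-∷ʳ-fromℕ (Vec.reverse xs) x)
lookup-reverse (x Vec.∷ xs) (suc i) =
  trans (cong (λ v → lookup v (opposite (suc i))) (Vecₚ.reverse-∷ x xs))
        (trans (lookup-∷ʳ-inject₁ (Vec.reverse xs) x (opposite i)) (lookup-reverse xs i))

module _ {k : ℕ} where

  ∑-allVecs-∷ʳ : (n : ℕ) (F : Vec (Fin k) (suc n) → ℚ) →
    ∑ (allVecs k (suc n)) F ≡ ∑[ τ ← allVecs k n ] ∑[ j ← allFin k ] F (τ Vec.∷ʳ j)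
  ∑-allVecs-∷ʳ zero F = ∑-allVecs-suc F
  ∑-allVecs-∷ʳ (suc n) F = begin
    ∑ (allVecs k (suc (suc n))) F
      ≡⟨ ∑-allVecs-suc F ⟩
    ∑[ σ ← allVecs k (suc n) ] ∑[ i ← allFin k ] F (i Vec.∷ σ)
      ≡⟨ ∑-allVecs-∷ʳ n (λ σ → ∑[ i ← allFin k ] F (i Vec.∷ σ)) ⟩
    ∑[ τ ← allVecs k n ] ∑[ j ← allFin k ] ∑[ i ← allFin k ] F (i Vec.∷ (τ Vec.∷ʳ j))
      ≡⟨ ∑-cong (allVecs k n) (λ τ → ∑-comm (allFin k) (allFin k) (λ j i → F (i Vec.∷ (τ Vec.∷ʳ j)))) ⟩
    ∑[ τ ← allVecs k n ] ∑[ i ← allFin k ] ∑[ j ← allFin k ] F ((i Vec.∷ τ) Vec.∷ʳ j)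
      ≡⟨ ∑-allVecs-suc (λ σ → ∑[ j ← allFin k ] F (σ Vec.∷ʳ j)) ⟨
    ∑[ σ ← allVecs k (suc n) ] ∑[ j ← allFin k ] F (σ Vec.∷ʳ j) ∎
    where open ≡-Reasoning

  ∑-allVecs-reverse : (n : ℕ) (F : Vec (Fin k) n → ℚ) → ∑ (allVecs k n) (F ∘ Vec.reverse) ≡ ∑ (allVecs k n) F
  ∑-allVecs-reverse zero F = refl
  ∑-allVecs-reverse (suc n) F = begin
    ∑ (allVecs k (suc n)) (F ∘ Vec.reverse)
      ≡⟨ ∑-allVecs-suc (F ∘ Vec.reverse) ⟩
    ∑[ τ ← allVecs k n ] ∑[ j ← allFin k ] F (Vec.reverse (j Vec.∷ τ))
      ≡⟨ ∑-cong (allVecs k n) (λ τ → ∑-cong (allFin k) (λ j → cong F (Vecₚ.reverse-∷ j τ))) ⟩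
    ∑[ τ ← allVecs k n ] ∑[ j ← allFin k ] F (Vec.reverse τ Vec.∷ʳ j)
      ≡⟨ ∑-allVecs-reverse n (λ τ → ∑[ j ← allFin k ] F (τ Vec.∷ʳ j)) ⟩
    ∑[ τ ← allVecs k n ] ∑[ j ← allFin k ] F (τ Vec.∷ʳ j)
      ≡⟨ ∑-allVecs-∷ʳ n F ⟨
    ∑ (allVecs k (suc n)) F ∎
    where open ≡-Reasoning

  ∑-allVecs-map-opposite : (n : ℕ) (F : Vec (Fin k) n → ℚ) → ∑ (allVecs k n) (F ∘ Vec.map opposite) ≡ ∑ (allVecs k n) F
  ∑-allVecs-map-opposite zero F = refl
  ∑-allVecs-map-opposite (suc n) F = begin
    ∑ (allVecs k (suc n)) (F ∘ Vec.map opposite)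
      ≡⟨ ∑-allVecs-suc (F ∘ Vec.map opposite) ⟩
    ∑[ τ ← allVecs k n ] ∑[ j ← allFin k ] F (opposite j Vec.∷ Vec.map opposite τ)
      ≡⟨ ∑-allVecs-map-opposite n (λ τ → ∑[ j ← allFin k ] F (opposite j Vec.∷ τ)) ⟩
    ∑[ τ ← allVecs k n ] ∑[ j ← allFin k ] F (opposite j Vec.∷ τ)
      ≡⟨ ∑-cong (allVecs k n) (λ τ → ∑-allFin-opposite (λ j → F (j Vec.∷ τ))) ⟩
    ∑[ τ ← allVecs k n ] ∑[ j ← allFin k ] F (j Vec.∷ τ)
      ≡⟨ ∑-allVecs-suc F ⟨
    ∑ (allVecs k (suc n)) F ∎
    where open ≡-Reasoning

dualMap : {n k : ℕ} → Vec (Fin k) n → Vec (Fin k) n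
dualMap σ = Vec.map opposite (Vec.reverse σ)

module _ {n k : ℕ} where

  lookup-dualMap : (σ : Vec (Fin k) n) (x : Fin n) → lookup (dualMap σ) x ≡ opposite (lookup σ (opposite x))
  lookup-dualMap σ x = trans (Vecₚ.lookup-map x opposite (Vec.reverse σ))
    (cong opposite (trans (cong (lookup (Vec.reverse σ)) (sym (Finₚ.opposite-involutive x))) (lookup-reverse σ (opposite x))))

  ∑-allVecs-dualMap : (F : Vec (Fin k) n → ℚ) → ∑ (allVecs k n) (F ∘ dualMap) ≡ ∑ (allVecs k n) F
  ∑-allVecs-dualMap F = trans (∑-allVecs-reverse n (F ∘ Vec.map opposite)) (∑-allVecs-map-opposite n F)

  orderPreserving-dualMap : (P : Poset n) (σ : Vec (Fin k) n) → orderPreserving (dual P) (dualMap σ) ≡ orderPreserving P σ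
  orderPreserving-dualMap P σ = begin
    orderPreserving (dual P) (dualMap σ)
      ≡⟨ all-cong (allFin n) (λ x → all-cong (allFin n) (λ y → cong (not (rel P (opposite y) (opposite x)) ∨_)
           (trans (cong₂ (λ a b → toℕ a ≤ᵇ toℕ b) (lookup-dualMap σ x) (lookup-dualMap σ y))
                  (opposite-≤ᵇ (lookup σ (opposite x)) (lookup σ (opposite y)))))) ⟩
    all (λ x → all (λ y → R (opposite y) (opposite x)) (allFin n)) (allFin n)
      ≡⟨ all-cong (allFin n) (λ x → all-opposite (λ y → R y (opposite x))) ⟩
    all (λ x → all (λ y → R y (opposite x)) (allFin n)) (allFin n)
      ≡⟨ all-opposite (λ x → all (λ y → R y x) (allFin n)) ⟩
    all (λ x → all (λ y → R y x) (allFin n)) (allFin n)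
      ≡⟨ all-comm (λ x y → R y x) ⟩
    orderPreserving P σ ∎
    where
    open ≡-Reasoning
    R : Fin n → Fin n → Bool
    R a b = not (rel P a b) ∨ (toℕ (lookup σ a) ≤ᵇ toℕ (lookup σ b))

  surjective-dualMap : (σ : Vec (Fin k) n) → surjective (dualMap σ) ≡ surjective σ
  surjective-dualMap σ = begin
    surjective (dualMap σ)
      ≡⟨ all-cong (allFin k) (λ j → any-cong (allFin n) (λ x →
           trans (cong (_==F j) (lookup-dualMap σ x)) (opposite-==F (lookup σ (opposite x)) j))) ⟩
    all (λ j → any (λ x → lookup σ (opposite x) ==F opposite j) (allFin n)) (allFin k)
      ≡⟨ all-cong (allFin k) (λ j → any-opposite (λ x → lookup σ x ==F opposite j)) ⟩
    all (hits σ ∘ opposite) (allFin k)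
      ≡⟨ all-opposite (hits σ) ⟩
    surjective σ ∎
    where open ≡-Reasoning

  fibreType-dualMap : (σ : Vec (Fin k) n) → fibreType (dualMap σ) ≡ reverse (fibreType σ)
  fibreType-dualMap σ = begin
    fibreType (dualMap σ)
      ≡⟨ Listₚ.map-cong (λ j → countᵇ-cong (allFin n) (λ x →
           trans (cong (_==F j) (lookup-dualMap σ x)) (opposite-==F (lookup σ (opposite x)) j))) (allFin k) ⟩
    map (λ j → countᵇ ((λ x → lookup σ x ==F opposite j) ∘ opposite) (allFin n)) (allFin k)
      ≡⟨ Listₚ.map-cong (λ j → countᵇ-opposite (λ x → lookup σ x ==F opposite j)) (allFin k) ⟩
    map (fibre ∘ opposite) (allFin k)
      ≡⟨ Listₚ.map-∘ (allFin k) ⟩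
    map fibre (map opposite (allFin k))
      ≡⟨ cong (map fibre) (map-opposite-allFin k) ⟩
    map fibre (reverse (allFin k))
      ≡⟨ Listₚ.reverse-map fibre (allFin k) ⟩
    reverse (fibreType σ) ∎
    where
    open ≡-Reasoning
    fibre : Fin k → ℕ
    fibre j = countᵇ (λ x → lookup σ x ==F j) (allFin n)

⟦⟧-K-dual : {n : ℕ} (f : LinFun) (P : Poset n) → ⟦ f ⟧ (K (dual P)) ≡ ⟦ f ∘ reverse ⟧ (K P)
⟦⟧-K-dual {n} f P = begin
  ⟦ f ⟧ (K (dual P))
    ≡⟨ ⟦⟧-K f (dual P) ⟩
  ∑[ k ← upTo (suc n) ] ∑[ σ ← allVecs k n ] [ opSurjective (dual P) σ ]· f (fibreType σ)
    ≡⟨ ∑-cong (upTo (suc n)) (λ k → ∑-allVecs-dualMap (λ σ → [ opSurjective (dual P) σ ]· f (fibreType σ))) ⟨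
  ∑[ k ← upTo (suc n) ] ∑[ σ ← allVecs k n ] [ opSurjective (dual P) (dualMap σ) ]· f (fibreType (dualMap σ))
    ≡⟨ ∑-cong (upTo (suc n)) (λ k → ∑-cong (allVecs k n) (λ σ → cong₂ [_]·_
         (cong₂ _∧_ (orderPreserving-dualMap P σ) (surjective-dualMap σ)) (cong f (fibreType-dualMap σ)))) ⟩
  ∑Surj P (λ σ → f (reverse (fibreType σ)))
    ≡⟨ ⟦⟧-K (f ∘ reverse) P ⟨
  ⟦ f ∘ reverse ⟧ (K P) ∎
  where open ≡-Reasoning

minFunctional-K : (i : ℕ) {n : ℕ} (P : Poset n) → NaturallyLabeled P →
  ⟦ maxFunctional (signedBinomial i) ∘ reverse ⟧ (K P) ≡ indicator (numMinimal P) i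
minFunctional-K i P nl = begin
  ⟦ maxFunctional (signedBinomial i) ∘ reverse ⟧ (K P) ≡⟨ ⟦⟧-K-dual (maxFunctional (signedBinomial i)) P ⟨
  ⟦ maxFunctional (signedBinomial i) ⟧ (K (dual P))    ≡⟨ maxFunctional-K i (dual P) (NaturallyLabeled-dual P nl) ⟩
  indicator (numMaximal (dual P)) i                    ≡⟨ cong (λ m → indicator m i) (numMaximal-dual P) ⟩
  indicator (numMinimal P) i                           ∎
  where open ≡-Reasoning

lemma3p2 : ((i : ℕ) → 1 ≤ i → ∃[ maxᵢ ] ((n : ℕ) (P : Poset n) → NaturallyLabeled P → ⟦ maxᵢ ⟧ (K P) ≡ indicator (numMaximal P) i))
           × ((i : ℕ) → 1 ≤ i → ∃[ minᵢ ] ((n : ℕ) (P : Poset n) → NaturallyLabeled P → ⟦ minᵢ ⟧ (K P) ≡ indicator (numMinimal P) i))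
lemma3p2 = (λ i _ → maxFunctional (signedBinomial i) , λ n → maxFunctional-K i)
         , (λ i _ → maxFunctional (signedBinomial i) ∘ reverse , λ n → minFunctional-K i)
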